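{- The formulas $\mathrm{RPHP}^k_{n,k-1}$ and $\mathrm{ERPHP}^k_{n,k-1}$ have Lasserre refutations of rank $9$.
   Context: $[n]=\{1,\dots,n\}$, $[a,b]=\{a,\dots,b\}$. $\mathrm{RPHP}^k_{n,k-1}$ is the CNF formula over variables $p_{u,v}$ ($u\in[k],v\in[n]$), $r_v$ ($v\in[n]$), $q_{v,w}$ ($v\in[n],w\in[k-1]$) with clauses: $p_{u,1}\lor\dots\lor p_{u,n}$ ($u\in[k]$); $\bar p_{u,v}\lor\bar p_{u',v}$ ($u\ne u'\in[k]$, $v\in[n]$); $\bar p_{u,v}\lor r_v$ ($u\in[k],v\in[n]$); $\bar r_v\lor q_{v,1}\lor\dots\lor q_{v,k-1}$ ($v\in[n]$); $\bar r_v\lor\bar r_{v'}\lor\bar q_{v,w}\lor\bar q_{v',w}$ ($v\ne v'\in[n]$, $w\in[k-1]$). $\mathrm{ERPHP}^k_{n,k-1}$ is the 3-CNF formula with variables $p_{u,v}$, $y_{u,v}$ ($u\in[k]$, $v\in[2,n-2]$), $r_v$, $r_{v,v'}$ ($v\ne v'\in[n]$), $q_{v,w}$, $z_{v,w}$ ($v\in[n]$, $w\in[k-3]$) and clauses: $p_{u,1}\lor p_{u,2}\lor y_{u,2}$; $\bar y_{u,v}\lor p_{u,v+1}\lor y_{u,v+1}$ ($v\in[2,n-3]$); $\bar y_{u,n-2}\lor p_{u,n-1}\lor p_{u,n}$ (all $u\in[k]$); $\bar r_v\lor q_{v,1}\lor z_{v,1}$; $\bar z_{v,w}\lor q_{v,w+1}\lor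 z_{v,w+1}$ ($w\in[k-4]$); $\bar z_{v,k-3}\lor q_{v,k-2}\lor q_{v,k-1}$ (all $v\in[n]$); $\bar p_{u,v}\lor\bar p_{u',v}$ ($u\ne u'$); $\bar p_{u,v}\lor r_v$; $\bar r_v\lor\bar r_{v'}\lor r_{v,v'}$ ($v\ne v'$); $\bar r_{v,v'}\lor\bar q_{v,w}\lor\bar q_{v',w}$ ($v\ne v'$, $w\in[k-1]$). Lasserre: a clause $\bigvee_{i\in I}x_i\lor\bigvee_{j\in J}\bar x_j$ is encoded as the real inequality $\sum_{i\in I}x_i+\sum_{j\in J}(1-x_j)-1\ge0$. A Lasserre refutation of a CNF is an expression $\sum_{t=1}^{\tau}\alpha_t\prod_{i\in I_t}x_i\prod_{j\in J_t}(1-x_j)\,p_t$ with reals $\alpha_t\ge0$, each $p_t$ being the polynomial of an encoded clause, an axiom $x_i^2-x_i$ or $x_i-x_i^2$, the constant $1$, or a square $g^2$ of an arbitrary real polynomial $g$, which expands to $-1$. Its rank is the maximum degree of the polynomials to which the summands $\prod_{i\in I_t}x_i\prod_{j\in J_t}(1-x_j)p_t$ expand. -}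

module Defs where

open import Data.Nat as ℕ using (ℕ; zero; suc; _∸_; _≡ᵇ_)
import Data.Nat.Properties as ℕP
open import Data.Unit using (⊤)
open import Data.Bool using (Bool; true; false; if_then_else_)
open import Data.Product using (Σ; _×_; _,_; proj₁; proj₂)
open import Data.Product.Properties using (≡-dec)
open import Data.List using (List; []; _∷_; _++_; map; concatMap; foldr; filter; length; upTo)
open import Data.List.Relation.Unary.All using (All; all?)
open import Data.List.Relation.Unary.Any using (Any)
open import Data.List.Membership.Propositional using (_∈_)
open import Data.Rational using (ℚ; 0ℚ; 1ℚ; _+_; _*_; -_; _≤_)
open import Relation.Binary.PropositionalEquality using (_≡_; _≢_)
open import Relation.Binary.Definitions using (DecidableEquality)
open import Relation.Nullary.Decidable using (does)

-- range a b = [a,b] = a, a+1, ..., b  (empty if b < a)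
range : ℕ → ℕ → List ℕ
range a b = map (a ℕ.+_) (upTo (suc b ∸ a))

[_] : ℕ → List ℕ
[ n ] = range 1 n

distinctPairs : List ℕ → List (ℕ × ℕ)
distinctPairs xs =
  concatMap (λ a → concatMap (λ b → if a ≡ᵇ b then [] else ((a , b) ∷ [])) xs) xs

-- Variables.  A variable is a triple (tag , i , j):
--   tag 0 : p_{i,j}      tag 1 : r_i  (j = 0)     tag 2 : q_{i,j}
--   tag 3 : y_{i,j}      tag 4 : r_{i,j}          tag 5 : z_{i,j}

Var : Set
Var = ℕ × ℕ × ℕ

_≟V_ : DecidableEquality Var
_≟V_ = ≡-dec ℕP._≟_ (≡-dec ℕP._≟_ ℕP._≟_)

P Y Q Z RR : ℕ → ℕ → Var
P u v = 0 , u , v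
Q v w = 2 , v , w
Y u v = 3 , u , v
RR v v' = 4 , v , v'
Z v w = 5 , v , w

R : ℕ → Var
R v = 1 , v , 0

Lit : Set
Lit = Var × Bool

Clause : Set
Clause = List Lit

CNF : Set
CNF = List Clause

pos neg : Var → Lit
pos x = x , true
neg x = x , false

IsVarOf : CNF → Var → Set
IsVarOf F x = Any (λ C → Any (λ l → proj₁ l ≡ x) C) F

RPHP : ℕ → ℕ → CNF
RPHP n k =
     map (λ u → map (λ v → pos (P u v)) [ n ]) [ k ]
  ++ concatMap (λ uu' → map (λ v → neg (P (proj₁ uu') v) ∷ neg (P (proj₂ uu') v) ∷ [])
                            [ n ]) (distinctPairs [ k ])
  ++ concatMap (λ u → map (λ v → neg (P u v) ∷ pos (R v) ∷ []) [ n ]) [ k ]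
  ++ map (λ v → neg (R v) ∷ map (λ w → pos (Q v w)) [ k ∸ 1 ]) [ n ]
  ++ concatMap (λ vv' → map (λ w → neg (R (proj₁ vv')) ∷ neg (R (proj₂ vv'))
                                   ∷ neg (Q (proj₁ vv') w) ∷ neg (Q (proj₂ vv') w) ∷ [])
                            [ k ∸ 1 ]) (distinctPairs [ n ])

-- ERPHP^k_{n,k-1}   (meaningful for n ≥ 4, k ≥ 4)

ERPHP : ℕ → ℕ → CNF
ERPHP n k =
     map (λ u → pos (P u 1) ∷ pos (P u 2) ∷ pos (Y u 2) ∷ []) [ k ]
  ++ concatMap (λ u → map (λ v → neg (Y u v) ∷ pos (P u (suc v)) ∷ pos (Y u (suc v)) ∷ [])
                          (range 2 (n ∸ 3))) [ k ]
  ++ map (λ u → neg (Y u (n ∸ 2)) ∷ pos (P u (n ∸ 1)) ∷ pos (P u n) ∷ []) [ k ]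
  ++ map (λ v → neg (R v) ∷ pos (Q v 1) ∷ pos (Z v 1) ∷ []) [ n ]
  ++ concatMap (λ v → map (λ w → neg (Z v w) ∷ pos (Q v (suc w)) ∷ pos (Z v (suc w)) ∷ [])
                          [ k ∸ 4 ]) [ n ]
  ++ map (λ v → neg (Z v (k ∸ 3)) ∷ pos (Q v (k ∸ 2)) ∷ pos (Q v (k ∸ 1)) ∷ []) [ n ]
  ++ concatMap (λ uu' → map (λ v → neg (P (proj₁ uu') v) ∷ neg (P (proj₂ uu') v) ∷ [])
                            [ n ]) (distinctPairs [ k ])
  ++ concatMap (λ u → map (λ v → neg (P u v) ∷ pos (R v) ∷ []) [ n ]) [ k ]
  ++ map (λ vv' → neg (R (proj₁ vv')) ∷ neg (R (proj₂ vv')) ∷ pos (RR (proj₁ vv') (proj₂ vv')) ∷ [])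
         (distinctPairs [ n ])
  ++ concatMap (λ vv' → map (λ w → neg (RR (proj₁ vv') (proj₂ vv'))
                                   ∷ neg (Q (proj₁ vv') w) ∷ neg (Q (proj₂ vv') w) ∷ [])
                            [ k ∸ 1 ]) (distinctPairs [ n ])

-- A monomial is a list of variables (a multiset: order irrelevant,
-- repetitions = powers); a polynomial is a finite formal sum of
-- coefficient-monomial pairs (not normalised).

Mono : Set
Mono = List Var

Poly : Set
Poly = List (ℚ × Mono)

cst : ℚ → Poly
cst c = (c , []) ∷ []

var : Var → Poly
var x = (1ℚ , x ∷ []) ∷ []

_⊕_ : Poly → Poly → Poly
p ⊕ q = p ++ q

_⊗_ : Poly → Poly → Poly
p ⊗ q = concatMap (λ am → map (λ bm → (proj₁ am * proj₁ bm , proj₂ am ++ proj₂ bm)) q) p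

scale : ℚ → Poly → Poly
scale c p = cst c ⊗ p

⊖_ : Poly → Poly
⊖ p = scale (- 1ℚ) p

sumP : List Poly → Poly
sumP = foldr _⊕_ []

prodP : List Poly → Poly
prodP = foldr _⊗_ (cst 1ℚ)

mult : Var → Mono → ℕ
mult x m = length (filter (x ≟V_) m)

sameMono? : Mono → Mono → Bool
sameMono? m m' = does (all? (λ x → mult x m ℕP.≟ mult x m') (m ++ m'))

sumℚ : List ℚ → ℚ
sumℚ = foldr _+_ 0ℚ

coeff : Poly → Mono → ℚ
coeff p m = sumℚ (map (λ am → if sameMono? (proj₂ am) m then proj₁ am else 0ℚ) p)

_≈P_ : Poly → Poly → Set
p ≈P q = ∀ m → coeff p m ≡ coeff q m

DegreeAtMost : ℕ → Poly → Set
DegreeAtMost d p = ∀ m → coeff p m ≢ 0ℚ → length m ℕ.≤ d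

PolyVarsIn : (Var → Set) → Poly → Set
PolyVarsIn S p = All (λ am → All S (proj₂ am)) p

litPoly : Lit → Poly
litPoly (x , true)  = var x
litPoly (x , false) = cst 1ℚ ⊕ (⊖ var x)

clausePoly : Clause → Poly
clausePoly C = sumP (map litPoly C) ⊕ cst (- 1ℚ)

data Premise (F : CNF) : Set where
  clause  : (C : Clause) → C ∈ F → Premise F
  axSq    : Var → Premise F
  axSq'   : Var → Premise F
  one     : Premise F
  square  : Poly → Premise F

premisePoly : ∀ {F} → Premise F → Poly
premisePoly (clause C _) = clausePoly C
premisePoly (axSq x)  = (var x ⊗ var x) ⊕ (⊖ var x)
premisePoly (axSq' x) = var x ⊕ (⊖ (var x ⊗ var x))
premisePoly one       = cst 1ℚ
premisePoly (square g) = g ⊗ g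

PremiseVarsOK : ∀ {F} → Premise F → Set
PremiseVarsOK (clause C _) = ⊤
PremiseVarsOK {F} (axSq x)  = IsVarOf F x
PremiseVarsOK {F} (axSq' x) = IsVarOf F x
PremiseVarsOK one       = ⊤
PremiseVarsOK {F} (square g) = PolyVarsIn (IsVarOf F) g

record Summand (F : CNF) : Set where
  constructor summand
  field
    α     : ℚ
    α≥0   : 0ℚ ≤ α
    I     : List Var
    J     : List Var
    prem  : Premise F
    I-ok  : All (IsVarOf F) I
    J-ok  : All (IsVarOf F) J
    p-ok  : PremiseVarsOK prem

summandPoly : ∀ {F} → Summand F → Poly
summandPoly t =
  scale (Summand.α t)
    (prodP (map var (Summand.I t))
      ⊗ (prodP (map (λ x → cst 1ℚ ⊕ (⊖ var x)) (Summand.J t))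
      ⊗ premisePoly (Summand.prem t)))

LasserreRefutation : CNF → ℕ → Set
LasserreRefutation F d =
  Σ (List (Summand F)) λ ts →
    (sumP (map summandPoly ts) ≈P cst (- 1ℚ))
    × All (λ t → DegreeAtMost d (summandPoly t)) ts

module Submission where

-- A Lasserre refutation of rank 9 is a list of summands, each of degree at
-- most 9, whose expansions add up to the constant -1.  Both refutations
-- follow the counting argument of the paper: the pigeon axioms give
-- Σ_{u,v} p_uv ≥ k; a used hole carries at most one pigeon
-- (Σ_u p_uv ≤ r_v); a used hole carries a colour (r_v ≤ Σ_w r_v q_vw); a
-- colour is carried by at most one used hole (Σ_v r_v q_vw ≤ 1).  Chaining
-- these gives k ≤ k - 1.  Both "at most one" steps are one identity: if
-- M s_i (1 - s_i) and M s_i s_j (i ≠ j) vanish, then the square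
-- M (1 - Σ s_i)² reduces to M (1 - Σ s_i).

open import Defs
open import Data.Nat using (ℕ; _≤_)
open import Data.Product using (_×_)

open import Data.Nat using (zero; suc; _∸_; z≤n; s≤s)

open import Algebra.Bundles using (CommutativeMonoid; CommutativeRing)
import Algebra.Properties.CommutativeSemigroup as CommSemigroupProps
import Algebra.Solver.Ring
open import Algebra.Solver.Ring.AlmostCommutativeRing using (fromCommutativeRing; _-Raw-AlmostCommutative⟶_)
open import Algebra.Structures using (IsCommutativeRing)
open import Relation.Binary.Definitions using (WeaklyDecidable)
open import Data.Bool using (true; false; if_then_else_; T)
open import Data.Empty using (⊥-elim)
open import Data.Unit using (tt)
open import Data.List using (List; []; _∷_; _++_; map; concatMap; foldr; filter; length; upTo; applyUpTo)
import Data.List.Properties as List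
open import Data.List.Membership.Propositional using (_∈_; find)
import Data.List.Membership.Propositional.Properties as ∈
open import Data.List.Relation.Unary.All as All using (All; []; _∷_; all?)
import Data.List.Relation.Unary.All.Properties as All
open import Data.List.Relation.Unary.Any as Any using (Any; here; there)
open import Data.List.Relation.Unary.AllPairs using ([]; _∷_)
open import Data.List.Relation.Unary.Unique.Propositional using (Unique)
import Data.List.Relation.Unary.Unique.Propositional.Properties as Unique
open import Data.Maybe as Maybe using (Maybe; just; nothing; maybe′)
import Data.Nat as ℕ
import Data.Nat.Properties as ℕ
open import Data.Product using (Σ; _,_; proj₁; proj₂)
open import Data.Rational as ℚ using (ℚ; 0ℚ; 1ℚ; _+_; _*_; -_)
import Data.Rational.Properties as ℚ
open import Function using (_∘_; mk⇔)
open import Relation.Binary.PropositionalEquality using (_≡_; _≢_; refl; sym; trans; cong; cong₂; subst; module ≡-Reasoning)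
open import Relation.Nullary using (Dec; yes; no)
open import Relation.Nullary.Decidable using (does; proof; map′; does-⇔; dec-false)
open import Relation.Nullary.Reflects using (Reflects; invert)

module Sums {c ℓ} (M : CommutativeMonoid c ℓ) where
  open CommutativeMonoid M renaming (refl to ≈-refl; sym to ≈-sym; trans to ≈-trans)
  open import Relation.Binary.Reasoning.Setoid setoid
  open import Algebra.Properties.CommutativeSemigroup commutativeSemigroup using (interchange)

  ∑ : {A : Set} → (A → Carrier) → List A → Carrier
  ∑ f xs = foldr _∙_ ε (map f xs)

  ∑-cong∈ : ∀ {A : Set} {f g : A → Carrier} xs → (∀ {x} → x ∈ xs → f x ≈ g x) → ∑ f xs ≈ ∑ g xs
  ∑-cong∈ []       f≈g = ≈-refl
  ∑-cong∈ (x ∷ xs) f≈g = ∙-cong (f≈g (here refl)) (∑-cong∈ xs (f≈g ∘ there))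

  ∑-cong : ∀ {A : Set} {f g : A → Carrier} xs → (∀ x → f x ≈ g x) → ∑ f xs ≈ ∑ g xs
  ∑-cong xs f≈g = ∑-cong∈ xs (λ {x} _ → f≈g x)

  ∑-ε : ∀ {A : Set} (xs : List A) → ∑ (λ _ → ε) xs ≈ ε
  ∑-ε []       = ≈-refl
  ∑-ε (x ∷ xs) = ≈-trans (identityˡ _) (∑-ε xs)

  ∑-∙ : ∀ {A : Set} (f g : A → Carrier) xs → ∑ (λ x → f x ∙ g x) xs ≈ ∑ f xs ∙ ∑ g xs
  ∑-∙ f g []       = ≈-sym (identityˡ ε)
  ∑-∙ f g (x ∷ xs) = ≈-trans (∙-cong ≈-refl (∑-∙ f g xs)) (interchange (f x) (g x) _ _)

  ∑-++ : ∀ {A : Set} (f : A → Carrier) xs ys → ∑ f (xs ++ ys) ≈ ∑ f xs ∙ ∑ f ys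
  ∑-++ f []       ys = ≈-sym (identityˡ _)
  ∑-++ f (x ∷ xs) ys = ≈-trans (∙-cong ≈-refl (∑-++ f xs ys)) (≈-sym (assoc (f x) _ _))

  ∑-concatMap : ∀ {A B : Set} (f : B → Carrier) (g : A → List B) xs →
                ∑ f (concatMap g xs) ≈ ∑ (λ x → ∑ f (g x)) xs
  ∑-concatMap f g []       = ≈-refl
  ∑-concatMap f g (x ∷ xs) = ≈-trans (∑-++ f (g x) (concatMap g xs)) (∙-cong ≈-refl (∑-concatMap f g xs))

  ∑-map : ∀ {A B : Set} (f : B → Carrier) (g : A → B) xs → ∑ f (map g xs) ≡ ∑ (f ∘ g) xs
  ∑-map f g xs = cong (foldr _∙_ ε) (sym (List.map-∘ xs))

  ∑-swap : ∀ {A B : Set} (g : A → B → Carrier) xs ys →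
           ∑ (λ x → ∑ (g x) ys) xs ≈ ∑ (λ y → ∑ (λ x → g x y) xs) ys
  ∑-swap g []       ys = ≈-sym (∑-ε ys)
  ∑-swap g (x ∷ xs) ys = begin
    ∑ (g x) ys ∙ ∑ (λ x → ∑ (g x) ys) xs          ≈⟨ ∙-cong ≈-refl (∑-swap g xs ys) ⟩
    ∑ (g x) ys ∙ ∑ (λ y → ∑ (λ x → g x y) xs) ys  ≈⟨ ∑-∙ (g x) _ ys ⟨
    ∑ (λ y → ∑ (λ x → g x y) (x ∷ xs)) ys         ∎

≡ᵇ-refl : ∀ a → (a ℕ.≡ᵇ a) ≡ true
≡ᵇ-refl zero    = refl
≡ᵇ-refl (suc a) = ≡ᵇ-refl a

≡ᵇ-false : ∀ a b → a ≢ b → (a ℕ.≡ᵇ b) ≡ false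
≡ᵇ-false a b a≢b with a ℕ.≡ᵇ b in eq
... | false = refl
... | true  = ⊥-elim (a≢b (ℕ.≡ᵇ⇒≡ a b (subst T (sym eq) tt)))

module RingSums {c ℓ} (R : CommutativeRing c ℓ) where
  private module R = CommutativeRing R
  open Sums R.+-commutativeMonoid public
  open import Relation.Binary.Reasoning.Setoid R.setoid
  open import Algebra.Properties.AbelianGroup R.+-abelianGroup using (⁻¹-∙-comm; ε⁻¹≈ε)
  open CommSemigroupProps R.+-commutativeSemigroup using (interchange)

  ∑-*ˡ : ∀ {A : Set} a (f : A → R.Carrier) xs → a R.* ∑ f xs R.≈ ∑ (λ x → a R.* f x) xs
  ∑-*ˡ a f []       = R.zeroʳ a
  ∑-*ˡ a f (x ∷ xs) = R.trans (R.distribˡ a (f x) _) (R.+-congˡ (∑-*ˡ a f xs))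

  ∑-*ʳ : ∀ {A : Set} a (f : A → R.Carrier) xs → ∑ f xs R.* a R.≈ ∑ (λ x → f x R.* a) xs
  ∑-*ʳ a f xs = R.trans (R.*-comm (∑ f xs) a) (R.trans (∑-*ˡ a f xs) (∑-cong xs (λ x → R.*-comm a (f x))))

  ∑-neg : ∀ {A : Set} (f : A → R.Carrier) xs → ∑ (λ x → R.- f x) xs R.≈ R.- ∑ f xs
  ∑-neg f []       = R.sym ε⁻¹≈ε
  ∑-neg f (x ∷ xs) = R.trans (R.+-congˡ (∑-neg f xs)) (⁻¹-∙-comm (f x) (∑ f xs))

  ∑-minus : ∀ {A : Set} (f g : A → R.Carrier) xs → ∑ (λ x → f x R.- g x) xs R.≈ ∑ f xs R.- ∑ g xs
  ∑-minus f g xs = R.trans (∑-∙ f (λ x → R.- g x) xs) (R.+-congˡ (∑-neg g xs))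

  ∑-count : ∀ {A B : Set} (xs : List A) (ys : List B) → length xs ≡ suc (length ys) →
            ∑ (λ _ → R.1#) ys R.- ∑ (λ _ → R.1#) xs R.≈ R.- R.1#
  ∑-count (x ∷ []) []       _  = R.trans (R.+-identityˡ _) (R.-‿cong (R.+-identityʳ R.1#))
  ∑-count (x ∷ x' ∷ xs) (y ∷ ys) eq = begin
    (R.1# R.+ Sy) R.- (R.1# R.+ Sx) ≈⟨ R.+-congˡ (R.sym (⁻¹-∙-comm R.1# Sx)) ⟩
    (R.1# R.+ Sy) R.+ (R.- R.1# R.+ R.- Sx) ≈⟨ interchange R.1# Sy (R.- R.1#) (R.- Sx) ⟩
    (R.1# R.- R.1#) R.+ (Sy R.- Sx) ≈⟨ R.+-congʳ (R.-‿inverseʳ R.1#) ⟩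
    R.0# R.+ (Sy R.- Sx) ≈⟨ R.+-identityˡ _ ⟩
    Sy R.- Sx ≈⟨ ∑-count (x' ∷ xs) ys (ℕ.suc-injective eq) ⟩
    R.- R.1# ∎
    where
    Sx = ∑ (λ _ → R.1#) (x' ∷ xs)
    Sy = ∑ (λ _ → R.1#) ys

  ∑-product : ∀ {A B : Set} (f : A → R.Carrier) (g : B → R.Carrier) xs ys →
              ∑ f xs R.* ∑ g ys R.≈ ∑ (λ x → ∑ (λ y → f x R.* g y) ys) xs
  ∑-product f g xs ys = R.trans (∑-*ʳ (∑ g ys) f xs) (∑-cong xs (λ x → ∑-*ˡ (f x) g ys))

  ∑-avoiding : ∀ a (g : ℕ → R.Carrier) xs → All (a ≢_) xs → ∑ (λ b → if a ℕ.≡ᵇ b then g b else R.0#) xs R.≈ R.0#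
  ∑-avoiding a g []       []          = R.refl
  ∑-avoiding a g (b ∷ xs) (a≢b ∷ a∉) rewrite ≡ᵇ-false a b a≢b = R.trans (R.+-identityˡ _) (∑-avoiding a g xs a∉)

  ∑-selecting : ∀ a (g : ℕ → R.Carrier) xs → Unique xs → a ∈ xs →
                ∑ (λ b → if a ℕ.≡ᵇ b then g b else R.0#) xs R.≈ g a
  ∑-selecting a g (b ∷ xs) (b∉ ∷ _) (here refl) rewrite ≡ᵇ-refl a =
    R.trans (R.+-congˡ (∑-avoiding a g xs b∉)) (R.+-identityʳ (g a))
  ∑-selecting a g (b ∷ xs) (b∉ ∷ u) (there a∈) rewrite ≡ᵇ-false a b (λ a≡b → All.lookup b∉ a∈ (sym a≡b)) =
    R.trans (R.+-identityˡ _) (∑-selecting a g xs u a∈)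

  ∑-distinctPairs : ∀ (h : ℕ × ℕ → R.Carrier) xs →
    ∑ h (distinctPairs xs) R.≈ ∑ (λ a → ∑ (λ b → if a ℕ.≡ᵇ b then R.0# else h (a , b)) xs) xs
  ∑-distinctPairs h xs =
    R.trans (∑-concatMap h _ xs) (∑-cong xs (λ a → R.trans (∑-concatMap h _ xs) (∑-cong xs (λ b → single (a ℕ.≡ᵇ b)))))
    where
    single : ∀ {a b} c → ∑ h (if c then [] else ((a , b) ∷ [])) R.≈ (if c then R.0# else h (a , b))
    single true  = R.refl
    single false = R.+-identityʳ _

  ∑-square : ∀ (f : ℕ → R.Carrier) xs → Unique xs →
    ∑ f xs R.* ∑ f xs R.≈ ∑ (λ a → f a R.* f a) xs R.+ ∑ (λ ab → f (proj₁ ab) R.* f (proj₂ ab)) (distinctPairs xs)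
  ∑-square f xs u = begin
    ∑ f xs R.* ∑ f xs                                ≈⟨ ∑-product f f xs xs ⟩
    ∑ (λ a → ∑ (λ b → f a R.* f b) xs) xs            ≈⟨ ∑-cong xs (λ a → R.trans (∑-cong xs (λ b → split (a ℕ.≡ᵇ b))) (∑-∙ _ _ xs)) ⟩
    ∑ (λ a → diagonal a R.+ offDiagonal a) xs        ≈⟨ ∑-∙ diagonal offDiagonal xs ⟩
    ∑ diagonal xs R.+ ∑ offDiagonal xs               ≈⟨ R.+-cong (∑-cong∈ xs (λ {a} a∈ → ∑-selecting a (λ b → f a R.* f b) xs u a∈))
                                                                 (R.sym (∑-distinctPairs (λ ab → f (proj₁ ab) R.* f (proj₂ ab)) xs)) ⟩
    ∑ (λ a → f a R.* f a) xs R.+ ∑ (λ ab → f (proj₁ ab) R.* f (proj₂ ab)) (distinctPairs xs) ∎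
    where
    diagonal offDiagonal : ℕ → R.Carrier
    diagonal    a = ∑ (λ b → if a ℕ.≡ᵇ b then f a R.* f b else R.0#) xs
    offDiagonal a = ∑ (λ b → if a ℕ.≡ᵇ b then R.0# else f a R.* f b) xs
    split : ∀ {x} c → x R.≈ (if c then x else R.0#) R.+ (if c then R.0# else x)
    split true  = R.sym (R.+-identityʳ _)
    split false = R.sym (R.+-identityˡ _)

infix 4 _∼_
_∼_ : Mono → Mono → Set
m ∼ m' = ∀ x → mult x m ≡ mult x m'

mult-++ : ∀ x a b → mult x (a ++ b) ≡ mult x a ℕ.+ mult x b
mult-++ x a b = trans (cong length (List.filter-++ (x ≟V_) a b)) (List.length-++ (filter (x ≟V_) a))

mult-self : ∀ x a → mult x (x ∷ a) ≡ suc (mult x a)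
mult-self x a with x ≟V x
... | yes _   = refl
... | no x≢x = ⊥-elim (x≢x refl)

mult≢0⇒∈ : ∀ x m → mult x m ≢ 0 → x ∈ m
mult≢0⇒∈ x m nz with filter (x ≟V_) m in eq
... | []    = ⊥-elim (nz refl)
... | y ∷ _ with ∈.∈-filter⁻ (x ≟V_) (subst (y ∈_) (sym eq) (here refl))
...   | y∈m , refl = y∈m

∼-cancel : ∀ x a b → x ∷ a ∼ x ∷ b → a ∼ b
∼-cancel x a b e y = ℕ.+-cancelˡ-≡ (mult y (x ∷ [])) _ _
  (trans (sym (mult-++ y (x ∷ []) a)) (trans (e y) (mult-++ y (x ∷ []) b)))

++-∼-comm : ∀ a b → a ++ b ∼ b ++ a
++-∼-comm a b x = trans (mult-++ x a b) (trans (ℕ.+-comm (mult x a) _) (sym (mult-++ x b a)))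

-- sameMono? decides _∼_: outside m ++ m' both multiplicities vanish.
∼-dec : ∀ m m' → Dec (m ∼ m')
∼-dec m m' = map′ sound (λ e → All.tabulate (λ {x} _ → e x)) (all? (λ x → mult x m ℕ.≟ mult x m') (m ++ m'))
  where
  sound : All (λ x → mult x m ≡ mult x m') (m ++ m') → m ∼ m'
  sound agree x with mult x m ℕ.≟ 0 | mult x m' ℕ.≟ 0
  ... | yes e | yes e' = trans e (sym e')
  ... | no nz | _      = All.lookup agree (∈.∈-++⁺ˡ (mult≢0⇒∈ x m nz))
  ... | yes _ | no nz  = All.lookup agree (∈.∈-++⁺ʳ m (mult≢0⇒∈ x m' nz))

sameMono?-sound : ∀ m m' → sameMono? m m' ≡ true → m ∼ m'
sameMono?-sound m m' eq = invert (subst (Reflects (m ∼ m')) eq (proof (∼-dec m m')))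

sameMono?-respˡ : ∀ {m₁ m₂} m → m₁ ∼ m₂ → sameMono? m₁ m ≡ sameMono? m₂ m
sameMono?-respˡ {m₁} {m₂} m e =
  does-⇔ (mk⇔ (λ f x → trans (sym (e x)) (f x)) (λ f x → trans (e x) (f x))) (∼-dec m₁ m) (∼-dec m₂ m)

removeOne : Var → Mono → Maybe Mono
removeOne x []      = nothing
removeOne x (y ∷ m) with x ≟V y
... | yes _ = just m
... | no _  = Maybe.map (y ∷_) (removeOne x m)

removeOne-nothing : ∀ x m → removeOne x m ≡ nothing → mult x m ≡ 0
removeOne-nothing x []      _  = refl
removeOne-nothing x (y ∷ m) eq with x ≟V y
... | no _ with removeOne x m in eq'
...   | nothing = removeOne-nothing x m eq'

removeOne-just : ∀ x m {m'} → removeOne x m ≡ just m' → m ∼ x ∷ m' × length m ≡ suc (length m')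
removeOne-just x (y ∷ m) eq with x ≟V y
removeOne-just x (y ∷ m) refl | yes refl = (λ _ → refl) , refl
... | no _ with removeOne x m in eq'
...   | just m″ with refl ← eq =
  (λ z → begin
    mult z (y ∷ m)                            ≡⟨ mult-++ z (y ∷ []) m ⟩
    mult z (y ∷ []) ℕ.+ mult z m              ≡⟨ cong (mult z (y ∷ []) ℕ.+_) (trans (m∼ z) (mult-++ z (x ∷ []) m″)) ⟩
    mult z (y ∷ []) ℕ.+ (mult z (x ∷ []) ℕ.+ mult z m″) ≡⟨ x∙yz≈y∙xz (mult z (y ∷ [])) (mult z (x ∷ [])) _ ⟩
    mult z (x ∷ []) ℕ.+ (mult z (y ∷ []) ℕ.+ mult z m″) ≡⟨ cong (mult z (x ∷ []) ℕ.+_) (mult-++ z (y ∷ []) m″) ⟨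
    mult z (x ∷ []) ℕ.+ mult z (y ∷ m″)       ≡⟨ mult-++ z (x ∷ []) (y ∷ m″) ⟨
    mult z (x ∷ y ∷ m″)                       ∎)
  , cong suc len
  where
  open ≡-Reasoning
  open CommSemigroupProps ℕ.+-commutativeSemigroup using (x∙yz≈y∙xz)
  m∼  = proj₁ (removeOne-just x m eq')
  len = proj₂ (removeOne-just x m eq')

sameMono?-∷ : ∀ x c m → sameMono? (x ∷ c) m ≡ maybe′ (sameMono? c) false (removeOne x m)
sameMono?-∷ x c m with removeOne x m in eq
... | nothing = dec-false (∼-dec (x ∷ c) m)
                  (λ e → ℕ.1+n≢0 (trans (sym (mult-self x c)) (trans (e x) (removeOne-nothing x m eq))))
... | just m' = does-⇔ (mk⇔ (λ e → ∼-cancel x c m' (λ z → trans (e z) (m∼ z)))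
                            (λ e z → trans (mult-++ z (x ∷ []) c) (trans (cong (mult z (x ∷ []) ℕ.+_) (e z))
                                     (trans (sym (mult-++ z (x ∷ []) m')) (sym (m∼ z))))))
                      (∼-dec (x ∷ c) m) (∼-dec c m')
  where m∼ = proj₁ (removeOne-just x m eq)

∼-length : ∀ a b → a ∼ b → length a ≡ length b
∼-length []      []      e = refl
∼-length []      (y ∷ b) e = ⊥-elim (ℕ.1+n≢0 (trans (sym (mult-self y b)) (sym (e y))))
∼-length (x ∷ a) b       e with removeOne x b in eq
... | nothing = ⊥-elim (ℕ.1+n≢0 (trans (sym (mult-self x a)) (trans (e x) (removeOne-nothing x b eq))))
... | just b' = trans (cong suc (∼-length a b' (∼-cancel x a b' (λ z → trans (e z) (proj₁ (removeOne-just x b eq) z)))))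
                      (sym (proj₂ (removeOne-just x b eq)))

divide : Mono → Mono → Maybe Mono
divide []      m = just m
divide (x ∷ a) m = removeOne x m Maybe.>>= divide a

sameMono?-++ : ∀ a b m → sameMono? (a ++ b) m ≡ maybe′ (sameMono? b) false (divide a m)
sameMono?-++ []      b m = refl
sameMono?-++ (x ∷ a) b m = trans (sameMono?-∷ x (a ++ b) m) (afterRemoval (removeOne x m))
  where
  afterRemoval : ∀ r → maybe′ (sameMono? (a ++ b)) false r ≡ maybe′ (sameMono? b) false (r Maybe.>>= divide a)
  afterRemoval nothing   = refl
  afterRemoval (just m') = sameMono?-++ a b m'

module ℚSum = Sums ℚ.+-0-commutativeMonoid

coeffOf : Mono → ℚ × Mono → ℚ
coeffOf m t = if sameMono? (proj₂ t) m then proj₁ t else 0ℚ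

_*ₜ_ : ℚ × Mono → ℚ × Mono → ℚ × Mono
t *ₜ s = (proj₁ t * proj₁ s , proj₂ t ++ proj₂ s)

coeff-++ : ∀ p q m → coeff (p ++ q) m ≡ coeff p m + coeff q m
coeff-++ p q m = ℚSum.∑-++ (coeffOf m) p q

coeff-⊗ : ∀ p q m → coeff (p ⊗ q) m ≡ ℚSum.∑ (λ t → ℚSum.∑ (λ s → coeffOf m (t *ₜ s)) q) p
coeff-⊗ []      q m = refl
coeff-⊗ (t ∷ p) q m =
  trans (coeff-++ (map (t *ₜ_) q) (p ⊗ q) m) (cong₂ _+_ (ℚSum.∑-map (coeffOf m) (t *ₜ_) q) (coeff-⊗ p q m))

coeffOf-*ₜ : ∀ m a ma t → coeffOf m ((a , ma) *ₜ t) ≡ maybe′ (λ m' → a * coeffOf m' t) 0ℚ (divide ma m)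
coeffOf-*ₜ m a ma (b , mb) rewrite sameMono?-++ ma mb m with divide ma m
... | nothing = refl
... | just m' = scale-if (sameMono? mb m')
  where
  scale-if : ∀ c → (if c then a * b else 0ℚ) ≡ a * (if c then b else 0ℚ)
  scale-if true  = refl
  scale-if false = sym (ℚ.*-zeroʳ a)

coeff-*ₜ : ∀ a ma q m → coeff (map ((a , ma) *ₜ_) q) m ≡ maybe′ (λ m' → a * coeff q m') 0ℚ (divide ma m)
coeff-*ₜ a ma []      m with divide ma m
... | nothing = refl
... | just _  = sym (ℚ.*-zeroʳ a)
coeff-*ₜ a ma (t ∷ q) m =
  trans (cong₂ _+_ (coeffOf-*ₜ m a ma t) (coeff-*ₜ a ma q m)) (collect (divide ma m))
  where
  collect : ∀ r → maybe′ (λ m' → a * coeffOf m' t) 0ℚ r + maybe′ (λ m' → a * coeff q m') 0ℚ r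
                ≡ maybe′ (λ m' → a * coeff (t ∷ q) m') 0ℚ r
  collect nothing   = ℚ.+-identityˡ 0ℚ
  collect (just m') = sym (ℚ.*-distribˡ-+ a _ _)

-- Equality of polynomials as expanded sums (a record, so that p and q can be inferred).
infix 4 _≈_
record _≈_ (p q : Poly) : Set where
  constructor mk≈
  field coeff-≡ : p ≈P q
open _≈_

≈-refl : ∀ {p} → p ≈ p
≈-refl = mk≈ λ _ → refl

≈-sym : ∀ {p q} → p ≈ q → q ≈ p
≈-sym e = mk≈ λ m → sym (coeff-≡ e m)

≈-trans : ∀ {p q r} → p ≈ q → q ≈ r → p ≈ r
≈-trans e f = mk≈ λ m → trans (coeff-≡ e m) (coeff-≡ f m)

≡⇒≈ : ∀ {p q} → p ≡ q → p ≈ q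
≡⇒≈ refl = ≈-refl

⊕-cong : ∀ {p p' q q'} → p ≈ p' → q ≈ q' → p ⊕ q ≈ p' ⊕ q'
⊕-cong {p} {p'} {q} {q'} e f =
  mk≈ λ m → trans (coeff-++ p q m) (trans (cong₂ _+_ (coeff-≡ e m) (coeff-≡ f m)) (sym (coeff-++ p' q' m)))

⊕-comm : ∀ p q → p ⊕ q ≈ q ⊕ p
⊕-comm p q = mk≈ λ m → trans (coeff-++ p q m) (trans (ℚ.+-comm (coeff p m) _) (sym (coeff-++ q p m)))

⊗-congʳ : ∀ p {q q'} → q ≈ q' → p ⊗ q ≈ p ⊗ q'
⊗-congʳ []             e = ≈-refl
⊗-congʳ ((a , ma) ∷ p) {q} {q'} e = mk≈ λ m → begin
  coeff (map ((a , ma) *ₜ_) q ++ p ⊗ q) m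
    ≡⟨ coeff-++ (map ((a , ma) *ₜ_) q) (p ⊗ q) m ⟩
  coeff (map ((a , ma) *ₜ_) q) m + coeff (p ⊗ q) m
    ≡⟨ cong₂ _+_ (coeff-*ₜ a ma q m) (coeff-≡ (⊗-congʳ p e) m) ⟩
  maybe′ (λ m' → a * coeff q m') 0ℚ (divide ma m) + coeff (p ⊗ q') m
    ≡⟨ cong (_+ coeff (p ⊗ q') m) (cong-maybe (divide ma m)) ⟩
  maybe′ (λ m' → a * coeff q' m') 0ℚ (divide ma m) + coeff (p ⊗ q') m
    ≡⟨ cong₂ _+_ (coeff-*ₜ a ma q' m) refl ⟨
  coeff (map ((a , ma) *ₜ_) q') m + coeff (p ⊗ q') m
    ≡⟨ coeff-++ (map ((a , ma) *ₜ_) q') (p ⊗ q') m ⟨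
  coeff (map ((a , ma) *ₜ_) q' ++ p ⊗ q') m ∎
  where
  open ≡-Reasoning
  cong-maybe : ∀ r → maybe′ (λ m' → a * coeff q m') 0ℚ r ≡ maybe′ (λ m' → a * coeff q' m') 0ℚ r
  cong-maybe nothing   = refl
  cong-maybe (just m') = cong (a *_) (coeff-≡ e m')

-- commutativity: the double sum of coeff-⊗ is symmetric up to swapping
⊗-comm : ∀ p q → p ⊗ q ≈ q ⊗ p
⊗-comm p q = mk≈ λ m → begin
  coeff (p ⊗ q) m                                                 ≡⟨ coeff-⊗ p q m ⟩
  ℚSum.∑ (λ t → ℚSum.∑ (λ s → coeffOf m (t *ₜ s)) q) p            ≡⟨ ℚSum.∑-swap (λ t s → coeffOf m (t *ₜ s)) p q ⟩
  ℚSum.∑ (λ s → ℚSum.∑ (λ t → coeffOf m (t *ₜ s)) p) q            ≡⟨ ℚSum.∑-cong q (λ s → ℚSum.∑-cong p (λ t → swap-terms m t s)) ⟩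
  ℚSum.∑ (λ s → ℚSum.∑ (λ t → coeffOf m (s *ₜ t)) p) q            ≡⟨ coeff-⊗ q p m ⟨
  coeff (q ⊗ p) m                                                 ∎
  where
  open ≡-Reasoning
  swap-terms : ∀ m t s → coeffOf m (t *ₜ s) ≡ coeffOf m (s *ₜ t)
  swap-terms m (a , ma) (b , mb) =
    cong₂ (λ c x → if c then x else 0ℚ) (sameMono?-respˡ {ma ++ mb} {mb ++ ma} m (++-∼-comm ma mb)) (ℚ.*-comm a b)

⊗-cong : ∀ {p p' q q'} → p ≈ p' → q ≈ q' → p ⊗ q ≈ p' ⊗ q'
⊗-cong {p} {p'} {q} {q'} e f =
  ≈-trans (⊗-comm p q) (≈-trans (⊗-congʳ q e) (≈-trans (⊗-comm q p') (⊗-congʳ p' f)))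

⊗-distribʳ : ∀ p q r → (q ⊕ r) ⊗ p ≡ (q ⊗ p) ⊕ (r ⊗ p)
⊗-distribʳ p q r = List.concatMap-++ (λ t → map (t *ₜ_) p) q r

⊗-distribˡ : ∀ p q r → p ⊗ (q ⊕ r) ≈ (p ⊗ q) ⊕ (p ⊗ r)
⊗-distribˡ p q r =
  ≈-trans (⊗-comm p (q ⊕ r)) (≈-trans (≡⇒≈ (⊗-distribʳ p q r)) (⊕-cong (⊗-comm q p) (⊗-comm r p)))

⊗-assoc : ∀ p q r → (p ⊗ q) ⊗ r ≡ p ⊗ (q ⊗ r)
⊗-assoc []      q r = refl
⊗-assoc (t ∷ p) q r = begin
  (map (t *ₜ_) q ++ p ⊗ q) ⊗ r       ≡⟨ ⊗-distribʳ r (map (t *ₜ_) q) (p ⊗ q) ⟩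
  map (t *ₜ_) q ⊗ r ++ (p ⊗ q) ⊗ r   ≡⟨ cong₂ _++_ (scale-⊗ q) (⊗-assoc p q r) ⟩
  map (t *ₜ_) (q ⊗ r) ++ p ⊗ (q ⊗ r) ∎
  where
  open ≡-Reasoning
  *ₜ-assoc : ∀ s u → (t *ₜ s) *ₜ u ≡ t *ₜ (s *ₜ u)
  *ₜ-assoc s u = cong₂ _,_ (ℚ.*-assoc (proj₁ t) (proj₁ s) (proj₁ u)) (List.++-assoc (proj₂ t) (proj₂ s) (proj₂ u))
  scale-⊗ : ∀ q → map (t *ₜ_) q ⊗ r ≡ map (t *ₜ_) (q ⊗ r)
  scale-⊗ []      = refl
  scale-⊗ (s ∷ q) = begin
    map ((t *ₜ s) *ₜ_) r ++ map (t *ₜ_) q ⊗ r        ≡⟨ cong₂ _++_ (trans (List.map-cong (*ₜ-assoc s) r) (List.map-∘ r)) (scale-⊗ q) ⟩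
    map (t *ₜ_) (map (s *ₜ_) r) ++ map (t *ₜ_) (q ⊗ r) ≡⟨ List.map-++ (t *ₜ_) (map (s *ₜ_) r) (q ⊗ r) ⟨
    map (t *ₜ_) (map (s *ₜ_) r ++ q ⊗ r)              ∎

⊗-identityˡ : ∀ p → cst 1ℚ ⊗ p ≈ p
⊗-identityˡ p = mk≈ λ m →
  trans (coeff-++ (map ((1ℚ , []) *ₜ_) p) [] m)
        (trans (ℚ.+-identityʳ _) (trans (coeff-*ₜ 1ℚ [] p m) (ℚ.*-identityˡ _)))

⊗-zeroʳ : ∀ p → p ⊗ [] ≡ []
⊗-zeroʳ []      = refl
⊗-zeroʳ (t ∷ p) = ⊗-zeroʳ p

minus-one-* : ∀ a → (- 1ℚ) * a ≡ - a
minus-one-* a = trans (sym (ℚ.neg-distribˡ-* 1ℚ a)) (cong -_ (ℚ.*-identityˡ a))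

⊖-inverseʳ : ∀ p → p ⊕ (⊖ p) ≈ []
⊖-inverseʳ p = mk≈ λ m → begin
  coeff (p ⊕ (⊖ p)) m                 ≡⟨ coeff-++ p (⊖ p) m ⟩
  coeff p m + coeff (⊖ p) m          ≡⟨ cong (coeff p m +_) (trans (coeff-++ (map ((- 1ℚ , []) *ₜ_) p) [] m) (ℚ.+-identityʳ _)) ⟩
  coeff p m + coeff (map ((- 1ℚ , []) *ₜ_) p) m ≡⟨ cong (coeff p m +_) (coeff-*ₜ (- 1ℚ) [] p m) ⟩
  coeff p m + (- 1ℚ) * coeff p m     ≡⟨ cong (coeff p m +_) (minus-one-* (coeff p m)) ⟩
  coeff p m + - coeff p m            ≡⟨ ℚ.+-inverseʳ (coeff p m) ⟩
  0ℚ                                 ∎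
  where open ≡-Reasoning

cst-+ : ∀ a b → cst (a + b) ≈ cst a ⊕ cst b
cst-+ a b = mk≈ λ m → split (sameMono? [] m)
  where
  split : ∀ c → (if c then a + b else 0ℚ) + 0ℚ ≡ (if c then a else 0ℚ) + ((if c then b else 0ℚ) + 0ℚ)
  split true  = ℚ.+-assoc a b 0ℚ
  split false = trans (ℚ.+-identityˡ 0ℚ) (sym (cong (0ℚ +_) (ℚ.+-identityˡ 0ℚ)))

cst-0 : cst 0ℚ ≈ []
cst-0 = mk≈ λ m → vanish (sameMono? [] m)
  where
  vanish : ∀ c → (if c then 0ℚ else 0ℚ) + 0ℚ ≡ 0ℚ
  vanish true  = refl
  vanish false = refl

cst-neg : ∀ a → cst (- a) ≈ (⊖ cst a)
cst-neg a = mk≈ λ m → cong (λ b → (if sameMono? [] m then b else 0ℚ) + 0ℚ) (sym (minus-one-* a))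

-- The operations of the polynomial ring.  They are opaque, so that the ring
-- solver compares normal forms syntactically instead of computing lists.
infixl 6 _+ₚ_ _-ₚ_
infixl 7 _*ₚ_
infix  8 -ₚ_

opaque
  _+ₚ_ _*ₚ_ : Poly → Poly → Poly
  p +ₚ q = p ⊕ q
  p *ₚ q = p ⊗ q

  -ₚ_ : Poly → Poly
  -ₚ p = ⊖ p

  κ : ℚ → Poly
  κ = cst

  0ₚ : Poly
  0ₚ = []

1ₚ : Poly
1ₚ = κ 1ℚ

_-ₚ_ : Poly → Poly → Poly
p -ₚ q = p +ₚ (-ₚ q)

opaque
  unfolding _+ₚ_

  polyIsCommutativeRing : IsCommutativeRing _≈_ _+ₚ_ _*ₚ_ -ₚ_ 0ₚ 1ₚ
  polyIsCommutativeRing = record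
    { isRing = record
      { +-isAbelianGroup = record
        { isGroup = record
          { isMonoid = record
            { isSemigroup = record
              { isMagma = record
                { isEquivalence = record { refl = ≈-refl ; sym = ≈-sym ; trans = ≈-trans }
                ; ∙-cong        = ⊕-cong
                }
              ; assoc = λ p q r → ≡⇒≈ (List.++-assoc p q r)
              }
            ; identity = (λ p → ≈-refl) , (λ p → ≡⇒≈ (List.++-identityʳ p))
            }
          ; inverse = (λ p → ≈-trans (⊕-comm (⊖ p) p) (⊖-inverseʳ p)) , ⊖-inverseʳ
          ; ⁻¹-cong = ⊗-congʳ (cst (- 1ℚ))
          }
        ; comm = ⊕-comm
        }
      ; *-cong     = ⊗-cong
      ; *-assoc    = λ p q r → ≡⇒≈ (⊗-assoc p q r)
      ; *-identity = ⊗-identityˡ , (λ p → ≈-trans (⊗-comm p (cst 1ℚ)) (⊗-identityˡ p))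
      ; distrib    = ⊗-distribˡ , (λ p q r → ≡⇒≈ (⊗-distribʳ p q r))
      }
    ; *-comm = ⊗-comm
    }

  κ-+ : ∀ a b → κ (a + b) ≈ κ a +ₚ κ b
  κ-+ = cst-+

  κ-* : ∀ a b → κ (a * b) ≈ κ a *ₚ κ b
  κ-* a b = ≈-refl

  κ-neg : ∀ a → κ (- a) ≈ -ₚ κ a
  κ-neg = cst-neg

  κ-0 : κ 0ℚ ≈ 0ₚ
  κ-0 = cst-0

polyRing : CommutativeRing _ _
polyRing = record { isCommutativeRing = polyIsCommutativeRing }

κ-morphism : ℚ.+-*-rawRing -Raw-AlmostCommutative⟶ fromCommutativeRing polyRing
κ-morphism = record
  { ⟦_⟧    = κ
  ; +-homo = κ-+
  ; *-homo = κ-*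
  ; -‿homo = κ-neg
  ; 0-homo = κ-0
  ; 1-homo = ≈-refl
  }

κ-≟ : WeaklyDecidable (λ a b → κ a ≈ κ b)
κ-≟ a b with a ℚ.≟ b
... | yes refl = just ≈-refl
... | no _     = nothing

module PolySolver = Algebra.Solver.Ring ℚ.+-*-rawRing (fromCommutativeRing polyRing) κ-morphism κ-≟
open PolySolver using (solve; _:=_; _:+_; _:*_; :-_; _:-_; con)

open RingSums polyRing
open CommutativeRing polyRing using (+-cong; +-comm; +-assoc; +-identityˡ; +-identityʳ; +-congˡ; +-congʳ; -‿cong; -‿inverseʳ; *-congˡ; *-identityˡ)

SynDeg : ℕ → Poly → Set
SynDeg d p = All (λ t → length (proj₂ t) ≤ d) p

⊗-preserves : ∀ {P Q S : ℚ × Mono → Set} {p q} → (∀ {t s} → P t → Q s → S (t *ₜ s)) →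
              All P p → All Q q → All S (p ⊗ q)
⊗-preserves mul hp hq = All.concat⁺ (All.map⁺ (All.map (λ ht → All.map⁺ (All.map (mul ht) hq)) hp))

synDeg-⊗ : ∀ {a b p q} → SynDeg a p → SynDeg b q → SynDeg (a ℕ.+ b) (p ⊗ q)
synDeg-⊗ = ⊗-preserves λ {t} ha hb → subst (_≤ _) (sym (List.length-++ (proj₂ t))) (ℕ.+-mono-≤ ha hb)

synDeg-mono : ∀ {a b p} → a ≤ b → SynDeg a p → SynDeg b p
synDeg-mono a≤b = All.map (λ h → ℕ.≤-trans h a≤b)

synDeg-var : ∀ x → SynDeg 1 (var x)
synDeg-var x = s≤s z≤n ∷ []

synDeg-⊖ : ∀ {d p} → SynDeg d p → SynDeg d (⊖ p)
synDeg-⊖ = synDeg-⊗ {0} {p = cst (- 1ℚ)} (z≤n ∷ [])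

synDeg-monomial : ∀ I → SynDeg (length I) (prodP (map var I))
synDeg-monomial []      = z≤n ∷ []
synDeg-monomial (x ∷ I) = synDeg-⊗ (synDeg-var x) (synDeg-monomial I)

synDeg-clause : ∀ C → SynDeg 1 (clausePoly C)
synDeg-clause C = All.++⁺ (literals C) (z≤n ∷ [])
  where
  literal : ∀ l → SynDeg 1 (litPoly l)
  literal (x , true)  = synDeg-var x
  literal (x , false) = z≤n ∷ synDeg-⊖ (synDeg-var x)
  literals : ∀ C → SynDeg 1 (sumP (map litPoly C))
  literals []      = []
  literals (l ∷ C) = All.++⁺ (literal l) (literals C)

synDeg⇒degree : ∀ d p → SynDeg d p → DegreeAtMost d p
synDeg⇒degree d []      []       m nz = ⊥-elim (nz refl)
synDeg⇒degree d (t ∷ p) (ht ∷ hp) m nz with sameMono? (proj₂ t) m in eq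
... | true  = subst (_≤ d) (∼-length (proj₂ t) m (sameMono?-sound (proj₂ t) m eq)) ht
... | false = synDeg⇒degree d p hp m (λ z → nz (trans (ℚ.+-identityˡ _) z))

pvs-⊗ : ∀ {S p q} → PolyVarsIn S p → PolyVarsIn S q → PolyVarsIn S (p ⊗ q)
pvs-⊗ = ⊗-preserves All.++⁺

∏ : List Var → Poly
∏ I = foldr (λ x acc → var x *ₚ acc) 1ₚ I

litₚ : Lit → Poly
litₚ (x , true)  = var x
litₚ (x , false) = 1ₚ -ₚ var x

clauseₚ : Clause → Poly
clauseₚ C = foldr (λ l acc → litₚ l +ₚ acc) (κ (- 1ℚ)) C

Derivable : ℕ → CNF → Poly → Set
Derivable d F p = Σ (List (Summand F)) λ ts → ∑ summandPoly ts ≈ p × All (λ t → DegreeAtMost d (summandPoly t)) ts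

opaque
  unfolding _+ₚ_

  synDeg-+ₚ : ∀ {d} p q → SynDeg d p → SynDeg d q → SynDeg d (p +ₚ q)
  synDeg-+ₚ p q = All.++⁺

  synDeg-*ₚ : ∀ {a b} p q → SynDeg a p → SynDeg b q → SynDeg (a ℕ.+ b) (p *ₚ q)
  synDeg-*ₚ p q = synDeg-⊗

  synDeg--ₚ : ∀ {d} p → SynDeg d p → SynDeg d (-ₚ p)
  synDeg--ₚ p = synDeg-⊖

  synDeg-κ : ∀ {d} a → SynDeg d (κ a)
  synDeg-κ a = z≤n ∷ []

  synDeg-∑ : ∀ {d} {A : Set} (f : A → Poly) xs → (∀ x → SynDeg d (f x)) → SynDeg d (∑ f xs)
  synDeg-∑ f []       h = []
  synDeg-∑ f (x ∷ xs) h = All.++⁺ (h x) (synDeg-∑ f xs h)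

  pvs-+ₚ : ∀ {S} p q → PolyVarsIn S p → PolyVarsIn S q → PolyVarsIn S (p +ₚ q)
  pvs-+ₚ p q = All.++⁺

  pvs-*ₚ : ∀ {S} p q → PolyVarsIn S p → PolyVarsIn S q → PolyVarsIn S (p *ₚ q)
  pvs-*ₚ p q = pvs-⊗

  pvs--ₚ : ∀ {S} p → PolyVarsIn S p → PolyVarsIn S (-ₚ p)
  pvs--ₚ p = pvs-⊗ {p = cst (- 1ℚ)} ([] ∷ [])

  pvs-κ : ∀ {S} a → PolyVarsIn S (κ a)
  pvs-κ a = [] ∷ []

  pvs-∑ : ∀ {S} {A : Set} (f : A → Poly) xs → (∀ {x} → x ∈ xs → PolyVarsIn S (f x)) → PolyVarsIn S (∑ f xs)
  pvs-∑ f []       h = []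
  pvs-∑ f (x ∷ xs) h = All.++⁺ (h (here refl)) (pvs-∑ f xs (h ∘ there))

  prodP-∏ : ∀ I → prodP (map var I) ≡ ∏ I
  prodP-∏ []      = refl
  prodP-∏ (x ∷ I) = cong (var x ⊗_) (prodP-∏ I)

  clausePoly-clauseₚ : ∀ C → clausePoly C ≡ clauseₚ C
  clausePoly-clauseₚ []      = refl
  clausePoly-clauseₚ (l ∷ C) =
    trans (List.++-assoc (litPoly l) (sumP (map litPoly C)) (cst (- 1ℚ))) (cong₂ _⊕_ (literal l) (clausePoly-clauseₚ C))
    where
    literal : ∀ l → litPoly l ≡ litₚ l
    literal (x , true)  = refl
    literal (x , false) = refl

  idempotency-poly : ∀ {F} x → premisePoly {F} (axSq x) ≡ var x *ₚ var x -ₚ var x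
  idempotency-poly x = refl

  idempotency'-poly : ∀ {F} x → premisePoly {F} (axSq' x) ≡ var x -ₚ var x *ₚ var x
  idempotency'-poly x = refl

  square-poly : ∀ {F} g → premisePoly {F} (square g) ≡ g *ₚ g
  square-poly g = refl

  summand-expansion : ∀ {F} I (prem : Premise F) (I-ok : All (IsVarOf F) I) (p-ok : PremiseVarsOK prem) →
    summandPoly (summand 1ℚ (ℚ.nonNegative⁻¹ 1ℚ) I [] prem I-ok [] p-ok) ≈ ∏ I *ₚ premisePoly prem
  summand-expansion I prem I-ok p-ok =
    ≈-trans (⊗-identityˡ _) (⊗-cong (≡⇒≈ (prodP-∏ I)) (⊗-identityˡ (premisePoly prem)))

  derivable⇒refutation : ∀ {d F} → Derivable d F (κ (- 1ℚ)) → LasserreRefutation F d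
  derivable⇒refutation (ts , sum≈ , degrees) = ts , coeff-≡ sum≈ , degrees

module _ {d : ℕ} {F : CNF} where

  derivable-≈ : ∀ {p q} → p ≈ q → Derivable d F p → Derivable d F q
  derivable-≈ p≈q (ts , sum≈ , degrees) = ts , ≈-trans sum≈ p≈q , degrees

  derivable-+ : ∀ {p q} → Derivable d F p → Derivable d F q → Derivable d F (p +ₚ q)
  derivable-+ (ts , sum≈ , degrees) (ts' , sum≈' , degrees') =
    ts ++ ts' , ≈-trans (∑-++ summandPoly ts ts') (+-cong sum≈ sum≈') , All.++⁺ degrees degrees'

  derivable-∑ : ∀ {A : Set} (f : A → Poly) xs → (∀ {x} → x ∈ xs → Derivable d F (f x)) → Derivable d F (∑ f xs)
  derivable-∑ f []       h = [] , ≈-refl , []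
  derivable-∑ f (x ∷ xs) h = derivable-+ (h (here refl)) (derivable-∑ f xs (h ∘ there))

  derivable-premise : ∀ I (prem : Premise F) → All (IsVarOf F) I → PremiseVarsOK prem →
    ∀ e → SynDeg e (premisePoly prem) → {T (length I ℕ.+ e ℕ.≤ᵇ d)} →
    ∀ {p} → premisePoly prem ≡ p → Derivable d F (∏ I *ₚ p)
  derivable-premise I prem I-ok p-ok e deg {bound} refl =
    summand 1ℚ (ℚ.nonNegative⁻¹ 1ℚ) I [] prem I-ok [] p-ok ∷ [] ,
    ≈-trans (+-identityʳ _) (summand-expansion I prem I-ok p-ok) ,
    synDeg⇒degree d _ (synDeg-mono (ℕ.≤ᵇ⇒≤ _ d bound)
      (synDeg-⊗ {0} {p = cst 1ℚ} (z≤n ∷ []) (synDeg-⊗ (synDeg-monomial I) (synDeg-⊗ {0} {p = cst 1ℚ} (z≤n ∷ []) deg)))) ∷ []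

  derivable-clause : ∀ I {C} → C ∈ F → All (IsVarOf F) I → {T (length I ℕ.+ 1 ℕ.≤ᵇ d)} →
                     Derivable d F (∏ I *ₚ clauseₚ C)
  derivable-clause I {C} C∈F I-ok {bound} =
    derivable-premise I (clause C C∈F) I-ok _ 1 (synDeg-clause C) {bound} (clausePoly-clauseₚ C)

  derivable-x²-x : ∀ I x → All (IsVarOf F) I → IsVarOf F x → {T (length I ℕ.+ 2 ℕ.≤ᵇ d)} →
                   Derivable d F (∏ I *ₚ (var x *ₚ var x -ₚ var x))
  derivable-x²-x I x I-ok x-ok {bound} = derivable-premise I (axSq x) I-ok x-ok 2
    (All.++⁺ (synDeg-⊗ (synDeg-var x) (synDeg-var x)) (synDeg-mono (s≤s z≤n) (synDeg-⊖ (synDeg-var x))))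
    {bound} (idempotency-poly {F} x)

  derivable-x-x² : ∀ I x → All (IsVarOf F) I → IsVarOf F x → {T (length I ℕ.+ 2 ℕ.≤ᵇ d)} →
                   Derivable d F (∏ I *ₚ (var x -ₚ var x *ₚ var x))
  derivable-x-x² I x I-ok x-ok {bound} = derivable-premise I (axSq' x) I-ok x-ok 2
    (All.++⁺ (synDeg-mono (s≤s z≤n) (synDeg-var x)) (synDeg-⊖ (synDeg-⊗ (synDeg-var x) (synDeg-var x))))
    {bound} (idempotency'-poly {F} x)

  derivable-square : ∀ I g → All (IsVarOf F) I → PolyVarsIn (IsVarOf F) g →
                     ∀ e → SynDeg e g → {T (length I ℕ.+ (e ℕ.+ e) ℕ.≤ᵇ d)} → Derivable d F (∏ I *ₚ (g *ₚ g))
  derivable-square I g I-ok g-ok e deg {bound} =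
    derivable-premise I (square g) I-ok g-ok (e ℕ.+ e) (synDeg-⊗ deg deg) {bound} (square-poly {F} g)

  -- If every s_i is Boolean and any two of them exclude each other (both
  -- times M), then M (1 - Σ s_i) is derivable: add these to the square
  -- M (1 - Σ s_i)² = M (1 - 2 Σ s_i + Σ s_i² + Σ_{i≠j} s_i s_j).
  atMostOne : ∀ (M : Poly) (s : ℕ → Poly) xs → Unique xs →
    Derivable d F (M *ₚ ((1ₚ -ₚ ∑ s xs) *ₚ (1ₚ -ₚ ∑ s xs))) →
    (∀ {i} → i ∈ xs → Derivable d F (M *ₚ (s i -ₚ s i *ₚ s i))) →
    (∀ {i j} → (i , j) ∈ distinctPairs xs → Derivable d F (-ₚ (M *ₚ (s i *ₚ s j)))) →
    Derivable d F (M *ₚ (1ₚ -ₚ ∑ s xs))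
  atMostOne M s xs unique squared boolean exclusion =
    derivable-≈ identity (derivable-+ squared (derivable-+ (derivable-∑ _ xs boolean) (derivable-∑ _ (distinctPairs xs) exclusion)))
    where
    S S² Sᵢⱼ : Poly
    S   = ∑ s xs
    S²  = ∑ (λ i → s i *ₚ s i) xs
    Sᵢⱼ = ∑ (λ ij → s (proj₁ ij) *ₚ s (proj₂ ij)) (distinctPairs xs)
    expand : M *ₚ ((1ₚ -ₚ S) *ₚ (1ₚ -ₚ S)) ≈ M *ₚ (1ₚ -ₚ S -ₚ S +ₚ (S² +ₚ Sᵢⱼ))
    expand = ≈-trans (solve 2 (λ M S → M :* ((con 1ℚ :- S) :* (con 1ℚ :- S)) := M :* (con 1ℚ :- S :- S :+ S :* S)) ≈-refl M S)
                     (*-congˡ (+-congˡ (∑-square s xs unique)))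
    boolean-sum : ∑ (λ i → M *ₚ (s i -ₚ s i *ₚ s i)) xs ≈ M *ₚ (S -ₚ S²)
    boolean-sum = ≈-trans (≈-sym (∑-*ˡ M _ xs)) (*-congˡ (∑-minus s (λ i → s i *ₚ s i) xs))
    exclusion-sum : ∑ (λ ij → -ₚ (M *ₚ (s (proj₁ ij) *ₚ s (proj₂ ij)))) (distinctPairs xs) ≈ -ₚ (M *ₚ Sᵢⱼ)
    exclusion-sum = ≈-trans (∑-neg _ (distinctPairs xs)) (-‿cong (≈-sym (∑-*ˡ M _ (distinctPairs xs))))
    identity : M *ₚ ((1ₚ -ₚ S) *ₚ (1ₚ -ₚ S)) +ₚ (∑ (λ i → M *ₚ (s i -ₚ s i *ₚ s i)) xs +ₚ
               ∑ (λ ij → -ₚ (M *ₚ (s (proj₁ ij) *ₚ s (proj₂ ij)))) (distinctPairs xs)) ≈ M *ₚ (1ₚ -ₚ S)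
    identity = ≈-trans (+-cong expand (+-cong boolean-sum exclusion-sum))
      (solve 4 (λ M S S² Sᵢⱼ → M :* (con 1ℚ :- S :- S :+ (S² :+ Sᵢⱼ)) :+ (M :* (S :- S²) :+ :- (M :* Sᵢⱼ))
                               := M :* (con 1ℚ :- S)) ≈-refl M S S² Sᵢⱼ)

nonEmpty : ∀ {A : Set} (xs : List A) {n} → length xs ≡ suc n → Σ A (_∈ xs)
nonEmpty (x ∷ _) _ = x , here refl

∈-concatMap⁺′ : ∀ {A B : Set} (f : A → List B) {x xs y} → x ∈ xs → y ∈ f x → y ∈ concatMap f xs
∈-concatMap⁺′ f x∈ y∈ = ∈.∈-concatMap⁺ f (Any.map (λ { refl → y∈ }) x∈)

∈-distinctPairs⁻ : ∀ {a b} xs → (a , b) ∈ distinctPairs xs → a ∈ xs × b ∈ xs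
∈-distinctPairs⁻ {a} {b} xs ab∈ with find (∈.∈-concatMap⁻ _ {xs = xs} ab∈)
... | a' , a'∈ , ab∈′ with find (∈.∈-concatMap⁻ _ {xs = xs} ab∈′)
...   | b' , b'∈ , ab∈″ with single (a' ℕ.≡ᵇ b') ab∈″
  where
  single : ∀ c → (a , b) ∈ (if c then [] else ((a' , b') ∷ [])) → a ≡ a' × b ≡ b'
  single false (here refl) = refl , refl
...     | refl , refl = a'∈ , b'∈

∈-distinctPairs⁺ : ∀ {a b} xs → a ∈ xs → b ∈ xs → a ≢ b → (a , b) ∈ distinctPairs xs
∈-distinctPairs⁺ {a} {b} xs a∈ b∈ a≢b = ∈-concatMap⁺′ _ a∈ (∈-concatMap⁺′ _ b∈ pair∈)
  where
  pair∈ : (a , b) ∈ (if a ℕ.≡ᵇ b then [] else ((a , b) ∷ []))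
  pair∈ rewrite ≡ᵇ-false a b a≢b = here refl

occursIn : ∀ {F C x} → C ∈ F → Any (λ l → proj₁ l ≡ x) C → IsVarOf F x
occursIn C∈F occurs = Any.map (λ { refl → occurs }) C∈F

pvs-var : ∀ {S x} → S x → PolyVarsIn S (var x)
pvs-var x-ok = (x-ok ∷ []) ∷ []

xP xQ : ℕ → ℕ → Poly
xP u v = var (P u v)
xQ v w = var (Q v w)

xR : ℕ → Poly
xR v = var (R v)

module CountingArgument
  (F : CNF) (pigeons holes colours : List ℕ)
  (pigeons-unique : Unique pigeons) (holes-unique : Unique holes)
  (fewer-colours : length pigeons ≡ suc (length colours))
  (hole-used : ∀ {u v} → u ∈ pigeons → v ∈ holes → (neg (P u v) ∷ pos (R v) ∷ []) ∈ F)
  (hole-exclusive : ∀ {u u' v} → (u , u') ∈ distinctPairs pigeons → v ∈ holes →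
                    (neg (P u v) ∷ neg (P u' v) ∷ []) ∈ F)
  (q-var : ∀ {v w} → v ∈ holes → w ∈ colours → IsVarOf F (Q v w))
  (pigeon-axiom : ∀ {u} → u ∈ pigeons → Derivable 9 F (∑ (xP u) holes -ₚ 1ₚ))
  (colouring-axiom : ∀ {v} → v ∈ holes → Derivable 9 F (xR v *ₚ ∑ (xQ v) colours -ₚ xR v))
  (colour-class-axiom : ∀ {v v' w} → (v , v') ∈ distinctPairs holes → w ∈ colours →
                        Derivable 9 F (-ₚ (xR v *ₚ xQ v w *ₚ (xR v' *ₚ xQ v' w))))
  where

  p-var : ∀ {u v} → u ∈ pigeons → v ∈ holes → IsVarOf F (P u v)
  p-var u∈ v∈ = occursIn (hole-used u∈ v∈) (here refl)

  r-var : ∀ {v} → v ∈ holes → IsVarOf F (R v)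
  r-var v∈ = occursIn (hole-used (proj₂ (nonEmpty pigeons fewer-colours)) v∈) (there (here refl))

  hole-capacity : ∀ {v} → v ∈ holes → Derivable 9 F (xR v -ₚ ∑ (λ u → xP u v) pigeons)
  hole-capacity {v} v∈ =
    derivable-≈ rearrange (derivable-+ (atMostOne (∏ (R v ∷ [])) (λ u → xP u v) pigeons pigeons-unique
                                                 squared boolean exclusive)
                                      (derivable-∑ _ pigeons occupying))
    where
    occupied : Poly
    occupied = ∑ (λ u → xP u v) pigeons
    squared : Derivable 9 F (∏ (R v ∷ []) *ₚ ((1ₚ -ₚ occupied) *ₚ (1ₚ -ₚ occupied)))
    squared = derivable-square (R v ∷ []) (1ₚ -ₚ occupied) (r-var v∈ ∷ [])
      (pvs-+ₚ 1ₚ _ (pvs-κ 1ℚ) (pvs--ₚ occupied (pvs-∑ _ pigeons (λ u∈ → pvs-var (p-var u∈ v∈))))) 1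
      (synDeg-+ₚ 1ₚ _ (synDeg-κ 1ℚ) (synDeg--ₚ occupied (synDeg-∑ _ pigeons (λ u → synDeg-var (P u v)))))
    boolean : ∀ {u} → u ∈ pigeons → Derivable 9 F (∏ (R v ∷ []) *ₚ (xP u v -ₚ xP u v *ₚ xP u v))
    boolean {u} u∈ = derivable-x-x² (R v ∷ []) (P u v) (r-var v∈ ∷ []) (p-var u∈ v∈)
    -- r p p' (¬p ∨ ¬p') + r p' (p² - p) + r p (p'² - p') = - r p p'
    exclusive : ∀ {u u'} → (u , u') ∈ distinctPairs pigeons →
                Derivable 9 F (-ₚ (∏ (R v ∷ []) *ₚ (xP u v *ₚ xP u' v)))
    exclusive {u} {u'} uu'∈ =
      derivable-≈ (solve 3 (λ r p p' →
          r :* (p :* (p' :* con 1ℚ)) :* ((con 1ℚ :- p) :+ ((con 1ℚ :- p') :+ con (- 1ℚ)))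
          :+ (r :* (p' :* con 1ℚ) :* (p :* p :- p) :+ r :* (p :* con 1ℚ) :* (p' :* p' :- p'))
          := :- (r :* con 1ℚ :* (p :* p'))) ≈-refl (xR v) (xP u v) (xP u' v))
        (derivable-+ (derivable-clause (R v ∷ P u v ∷ P u' v ∷ []) (hole-exclusive uu'∈ v∈) (rv ∷ pu ∷ pu' ∷ []))
          (derivable-+ (derivable-x²-x (R v ∷ P u' v ∷ []) (P u v) (rv ∷ pu' ∷ []) pu)
                       (derivable-x²-x (R v ∷ P u v ∷ []) (P u' v) (rv ∷ pu ∷ []) pu')))
      where
      u∈  = proj₁ (∈-distinctPairs⁻ pigeons uu'∈)
      u'∈ = proj₂ (∈-distinctPairs⁻ pigeons uu'∈)
      rv  = r-var v∈
      pu  = p-var u∈ v∈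
      pu' = p-var u'∈ v∈
    -- p (¬p ∨ r) + (p² - p) = p r - p
    occupying : ∀ {u} → u ∈ pigeons → Derivable 9 F (xP u v *ₚ xR v -ₚ xP u v)
    occupying {u} u∈ =
      derivable-≈ (solve 2 (λ p r → p :* con 1ℚ :* ((con 1ℚ :- p) :+ (r :+ con (- 1ℚ))) :+ con 1ℚ :* (p :* p :- p)
                                    := p :* r :- p) ≈-refl (xP u v) (xR v))
        (derivable-+ (derivable-clause (P u v ∷ []) (hole-used u∈ v∈) (p-var u∈ v∈ ∷ []))
                     (derivable-x²-x [] (P u v) [] (p-var u∈ v∈)))
    rearrange : ∏ (R v ∷ []) *ₚ (1ₚ -ₚ occupied) +ₚ ∑ (λ u → xP u v *ₚ xR v -ₚ xP u v) pigeons ≈ xR v -ₚ occupied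
    rearrange = ≈-trans (+-congˡ (≈-trans (∑-minus _ _ pigeons) (+-congʳ (≈-sym (∑-*ʳ (xR v) (λ u → xP u v) pigeons)))))
      (solve 2 (λ r S → r :* con 1ℚ :* (con 1ℚ :- S) :+ (S :* r :- S) := r :- S) ≈-refl (xR v) occupied)

  colour-capacity : ∀ {w} → w ∈ colours → Derivable 9 F (1ₚ -ₚ ∑ (λ v → xR v *ₚ xQ v w) holes)
  colour-capacity {w} w∈ =
    derivable-≈ (*-identityˡ _) (atMostOne (∏ []) carries holes holes-unique squared boolean exclusive)
    where
    carries : ℕ → Poly
    carries v = xR v *ₚ xQ v w
    squared : Derivable 9 F (∏ [] *ₚ ((1ₚ -ₚ ∑ carries holes) *ₚ (1ₚ -ₚ ∑ carries holes)))
    squared = derivable-square [] (1ₚ -ₚ ∑ carries holes) []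
      (pvs-+ₚ 1ₚ _ (pvs-κ 1ℚ) (pvs--ₚ _ (pvs-∑ carries holes
        (λ v∈ → pvs-*ₚ (xR _) (xQ _ w) (pvs-var (r-var v∈)) (pvs-var (q-var v∈ w∈)))))) 2
      (synDeg-+ₚ 1ₚ _ (synDeg-κ 1ℚ) (synDeg--ₚ _ (synDeg-∑ carries holes
        (λ v → synDeg-*ₚ (xR v) (xQ v w) (synDeg-var (R v)) (synDeg-var (Q v w))))))
    -- q² (r - r²) + r (q - q²) = r q - (r q)²
    boolean : ∀ {v} → v ∈ holes → Derivable 9 F (∏ [] *ₚ (carries v -ₚ carries v *ₚ carries v))
    boolean {v} v∈ =
      derivable-≈ (solve 2 (λ r q → q :* (q :* con 1ℚ) :* (r :- r :* r) :+ r :* con 1ℚ :* (q :- q :* q)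
                                    := con 1ℚ :* (r :* q :- r :* q :* (r :* q))) ≈-refl (xR v) (xQ v w))
        (derivable-+ (derivable-x-x² (Q v w ∷ Q v w ∷ []) (R v) (qv ∷ qv ∷ []) (r-var v∈))
                     (derivable-x-x² (R v ∷ []) (Q v w) (r-var v∈ ∷ []) qv))
      where qv = q-var v∈ w∈
    exclusive : ∀ {v v'} → (v , v') ∈ distinctPairs holes → Derivable 9 F (-ₚ (∏ [] *ₚ (carries v *ₚ carries v')))
    exclusive vv'∈ = derivable-≈ (-‿cong (≈-sym (*-identityˡ _))) (colour-class-axiom vv'∈ w∈)

  -- Summing all the axioms and capacities, every quantity except the
  -- number of pigeons and of colours cancels:  Σ_w 1 - Σ_u 1 = -1.
  refutation : LasserreRefutation F 9
  refutation = derivable⇒refutation (derivable-≈ total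
    (derivable-+ (derivable-∑ _ pigeons pigeon-axiom)
    (derivable-+ (derivable-∑ _ holes hole-capacity)
    (derivable-+ (derivable-∑ _ holes colouring-axiom)
                 (derivable-∑ _ colours colour-capacity)))))
    where
    placed used coloured #pigeons #colours : Poly
    placed   = ∑ (λ u → ∑ (xP u) holes) pigeons
    used     = ∑ xR holes
    coloured = ∑ (λ w → ∑ (λ v → xR v *ₚ xQ v w) holes) colours
    #pigeons = ∑ (λ _ → 1ₚ) pigeons
    #colours = ∑ (λ _ → 1ₚ) colours
    pigeon-sum : ∑ (λ u → ∑ (xP u) holes -ₚ 1ₚ) pigeons ≈ placed -ₚ #pigeons
    pigeon-sum = ∑-minus _ _ pigeons
    hole-sum : ∑ (λ v → xR v -ₚ ∑ (λ u → xP u v) pigeons) holes ≈ used -ₚ placed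
    hole-sum = ≈-trans (∑-minus _ _ holes) (+-congˡ (-‿cong (∑-swap (λ v u → xP u v) holes pigeons)))
    colouring-sum : ∑ (λ v → xR v *ₚ ∑ (xQ v) colours -ₚ xR v) holes ≈ coloured -ₚ used
    colouring-sum = ≈-trans (∑-minus _ _ holes)
      (+-congʳ (≈-trans (∑-cong holes (λ v → ∑-*ˡ (xR v) (xQ v) colours)) (∑-swap (λ v w → xR v *ₚ xQ v w) holes colours)))
    colour-sum : ∑ (λ w → 1ₚ -ₚ ∑ (λ v → xR v *ₚ xQ v w) holes) colours ≈ #colours -ₚ coloured
    colour-sum = ∑-minus _ _ colours
    total : ∑ (λ u → ∑ (xP u) holes -ₚ 1ₚ) pigeons +ₚ (∑ (λ v → xR v -ₚ ∑ (λ u → xP u v) pigeons) holes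
            +ₚ (∑ (λ v → xR v *ₚ ∑ (xQ v) colours -ₚ xR v) holes
            +ₚ ∑ (λ w → 1ₚ -ₚ ∑ (λ v → xR v *ₚ xQ v w) holes) colours)) ≈ κ (- 1ℚ)
    total = ≈-trans (+-cong pigeon-sum (+-cong hole-sum (+-cong colouring-sum colour-sum)))
      (≈-trans (solve 5 (λ A B C np nc → A :- np :+ (B :- A :+ (C :- B :+ (nc :- C))) := nc :- np)
                        ≈-refl placed used coloured #pigeons #colours)
      (≈-trans (∑-count pigeons colours fewer-colours) (≈-sym (κ-neg 1ℚ))))

[]-unique : ∀ n → Unique [ n ]
[]-unique n = Unique.map⁺ ℕ.suc-injective (Unique.upTo⁺ n)

[]-length : ∀ n → length [ n ] ≡ n
[]-length n = trans (List.length-map (1 ℕ.+_) (upTo n)) (List.length-upTo n)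

∈⇒occurs : ∀ {l : Lit} {C : Clause} → l ∈ C → Any (λ l' → proj₁ l' ≡ proj₁ l) C
∈⇒occurs (here refl) = here refl
∈⇒occurs (there l∈) = there (∈⇒occurs l∈)

clauseₚ-positive : ∀ {A : Set} (f : A → Var) xs → clauseₚ (map (λ a → pos (f a)) xs) ≈ ∑ (λ a → var (f a)) xs -ₚ 1ₚ
clauseₚ-positive f []       = ≈-trans (κ-neg 1ℚ) (≈-sym (+-identityˡ _))
clauseₚ-positive f (x ∷ xs) = ≈-trans (+-congˡ (clauseₚ-positive f xs)) (≈-sym (+-assoc (var (f x)) _ _))

-- The refutation of RPHP^k_{n,k-1}: the pigeon and colouring axioms are
-- clauses, and a colour-class axiom is the clause ¬r_v ∨ ¬r_v' ∨ ¬q_vw ∨ ¬q_v'w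
-- times r_v r_v' q_vw q_v'w, cleaned up with Boolean axioms.
module RPHPRefutation (n k' : ℕ) where
  k : ℕ
  k = suc k'

  F : CNF
  F = RPHP n k

  pigeon-clauses exclusion-clauses hole-clauses colouring-clauses : CNF
  pigeon-clauses    = map (λ u → map (λ v → pos (P u v)) [ n ]) [ k ]
  exclusion-clauses = concatMap (λ uu' → map (λ v → neg (P (proj₁ uu') v) ∷ neg (P (proj₂ uu') v) ∷ []) [ n ])
                                (distinctPairs [ k ])
  hole-clauses      = concatMap (λ u → map (λ v → neg (P u v) ∷ pos (R v) ∷ []) [ n ]) [ k ]
  colouring-clauses = map (λ v → neg (R v) ∷ map (λ w → pos (Q v w)) [ k' ]) [ n ]

  pigeon-clause : ∀ {u} → u ∈ [ k ] → map (λ v → pos (P u v)) [ n ] ∈ F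
  pigeon-clause u∈ = ∈.∈-++⁺ˡ (∈.∈-map⁺ (λ u → map (λ v → pos (P u v)) [ n ]) u∈)

  exclusion-clause : ∀ {u u' v} → (u , u') ∈ distinctPairs [ k ] → v ∈ [ n ] → (neg (P u v) ∷ neg (P u' v) ∷ []) ∈ F
  exclusion-clause {u} {u'} uu'∈ v∈ = ∈.∈-++⁺ʳ pigeon-clauses (∈.∈-++⁺ˡ
    (∈-concatMap⁺′ (λ uu' → map (λ v → neg (P (proj₁ uu') v) ∷ neg (P (proj₂ uu') v) ∷ []) [ n ]) uu'∈
      (∈.∈-map⁺ (λ v → neg (P u v) ∷ neg (P u' v) ∷ []) v∈)))

  hole-clause : ∀ {u v} → u ∈ [ k ] → v ∈ [ n ] → (neg (P u v) ∷ pos (R v) ∷ []) ∈ F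
  hole-clause {u} u∈ v∈ = ∈.∈-++⁺ʳ pigeon-clauses (∈.∈-++⁺ʳ exclusion-clauses (∈.∈-++⁺ˡ
    (∈-concatMap⁺′ (λ u → map (λ v → neg (P u v) ∷ pos (R v) ∷ []) [ n ]) u∈
      (∈.∈-map⁺ (λ v → neg (P u v) ∷ pos (R v) ∷ []) v∈))))

  colouring-clause : ∀ {v} → v ∈ [ n ] → (neg (R v) ∷ map (λ w → pos (Q v w)) [ k' ]) ∈ F
  colouring-clause v∈ = ∈.∈-++⁺ʳ pigeon-clauses (∈.∈-++⁺ʳ exclusion-clauses (∈.∈-++⁺ʳ hole-clauses (∈.∈-++⁺ˡ
    (∈.∈-map⁺ (λ v → neg (R v) ∷ map (λ w → pos (Q v w)) [ k' ]) v∈))))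

  colour-class-clause : ∀ {v v' w} → (v , v') ∈ distinctPairs [ n ] → w ∈ [ k' ] →
                        (neg (R v) ∷ neg (R v') ∷ neg (Q v w) ∷ neg (Q v' w) ∷ []) ∈ F
  colour-class-clause {v} {v'} vv'∈ w∈ =
    ∈.∈-++⁺ʳ pigeon-clauses (∈.∈-++⁺ʳ exclusion-clauses (∈.∈-++⁺ʳ hole-clauses (∈.∈-++⁺ʳ colouring-clauses
      (∈-concatMap⁺′ (λ vv' → map (λ w → neg (R (proj₁ vv')) ∷ neg (R (proj₂ vv')) ∷ neg (Q (proj₁ vv') w)
                                         ∷ neg (Q (proj₂ vv') w) ∷ []) [ k' ]) vv'∈
        (∈.∈-map⁺ (λ w → neg (R v) ∷ neg (R v') ∷ neg (Q v w) ∷ neg (Q v' w) ∷ []) w∈)))))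

  r-var : ∀ {v} → v ∈ [ n ] → IsVarOf F (R v)
  r-var v∈ = occursIn (colouring-clause v∈) (here refl)

  q-var : ∀ {v w} → v ∈ [ n ] → w ∈ [ k' ] → IsVarOf F (Q v w)
  q-var {v} v∈ w∈ = occursIn (colouring-clause v∈) (there (∈⇒occurs (∈.∈-map⁺ (λ w → pos (Q v w)) w∈)))

  pigeon-axiom : ∀ {u} → u ∈ [ k ] → Derivable 9 F (∑ (xP u) [ n ] -ₚ 1ₚ)
  pigeon-axiom {u} u∈ =
    derivable-≈ (≈-trans (*-identityˡ _) (clauseₚ-positive (P u) [ n ])) (derivable-clause [] (pigeon-clause u∈) [])

  -- r (¬r ∨ ⋁_w q_vw) + (r² - r) = r Σ_w q_vw - r
  colouring-axiom : ∀ {v} → v ∈ [ n ] → Derivable 9 F (xR v *ₚ ∑ (xQ v) [ k' ] -ₚ xR v)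
  colouring-axiom {v} v∈ =
    derivable-≈ (≈-trans (+-congʳ (*-congˡ (+-congˡ (clauseₚ-positive (Q v) [ k' ]))))
                         (solve 2 (λ r S → r :* con 1ℚ :* ((con 1ℚ :- r) :+ (S :- con 1ℚ)) :+ con 1ℚ :* (r :* r :- r)
                                          := r :* S :- r) ≈-refl (xR v) (∑ (xQ v) [ k' ])))
      (derivable-+ (derivable-clause (R v ∷ []) (colouring-clause v∈) (r-var v∈ ∷ []))
                   (derivable-x²-x [] (R v) [] (r-var v∈)))

  -- r r' q q' (¬r ∨ ¬r' ∨ ¬q ∨ ¬q') + Boolean axioms = - r q r' q'
  colour-class-axiom : ∀ {v v' w} → (v , v') ∈ distinctPairs [ n ] → w ∈ [ k' ] →
                       Derivable 9 F (-ₚ (xR v *ₚ xQ v w *ₚ (xR v' *ₚ xQ v' w)))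
  colour-class-axiom {v} {v'} {w} vv'∈ w∈ =
    derivable-≈ (solve 4 (λ r r' q q' →
        r :* (r' :* (q :* (q' :* con 1ℚ))) :* ((con 1ℚ :- r) :+ ((con 1ℚ :- r') :+ ((con 1ℚ :- q) :+ ((con 1ℚ :- q') :+ con (- 1ℚ)))))
        :+ (r' :* (q :* (q' :* con 1ℚ)) :* (r :* r :- r)
        :+ (r :* (q :* (q' :* con 1ℚ)) :* (r' :* r' :- r')
        :+ (r :* (r' :* (q' :* con 1ℚ)) :* (q :* q :- q)
        :+ r :* (r' :* (q :* con 1ℚ)) :* (q' :* q' :- q'))))
        := :- (r :* q :* (r' :* q'))) ≈-refl (xR v) (xR v') (xQ v w) (xQ v' w))
      (derivable-+ (derivable-clause (R v ∷ R v' ∷ Q v w ∷ Q v' w ∷ []) (colour-class-clause vv'∈ w∈) (rv ∷ rv' ∷ qv ∷ qv' ∷ []))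
      (derivable-+ (derivable-x²-x (R v' ∷ Q v w ∷ Q v' w ∷ []) (R v) (rv' ∷ qv ∷ qv' ∷ []) rv)
      (derivable-+ (derivable-x²-x (R v ∷ Q v w ∷ Q v' w ∷ []) (R v') (rv ∷ qv ∷ qv' ∷ []) rv')
      (derivable-+ (derivable-x²-x (R v ∷ R v' ∷ Q v' w ∷ []) (Q v w) (rv ∷ rv' ∷ qv' ∷ []) qv)
                   (derivable-x²-x (R v ∷ R v' ∷ Q v w ∷ []) (Q v' w) (rv ∷ rv' ∷ qv ∷ []) qv')))))
    where
    v∈  = proj₁ (∈-distinctPairs⁻ [ n ] vv'∈)
    v'∈ = proj₂ (∈-distinctPairs⁻ [ n ] vv'∈)
    rv  = r-var v∈
    rv' = r-var v'∈
    qv  = q-var v∈ w∈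
    qv' = q-var v'∈ w∈

  open CountingArgument F [ k ] [ n ] [ k' ] ([]-unique k) ([]-unique n)
    (trans ([]-length k) (cong suc (sym ([]-length k'))))
    hole-clause exclusion-clause q-var pigeon-axiom colouring-axiom colour-class-axiom
    public using (refutation)

Σ< : ℕ → (ℕ → Poly) → Poly
Σ< zero    f = 0ₚ
Σ< (suc j) f = f 0 +ₚ Σ< j (f ∘ suc)

∑-applyUpTo : ∀ (h : ℕ → Poly) f j → ∑ h (applyUpTo f j) ≡ Σ< j (h ∘ f)
∑-applyUpTo h f zero    = refl
∑-applyUpTo h f (suc j) = cong (h (f 0) +ₚ_) (∑-applyUpTo h (f ∘ suc) j)

∑-range : ∀ (h : ℕ → Poly) a b → ∑ h (range a b) ≡ Σ< (suc b ∸ a) (λ i → h (a ℕ.+ i))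
∑-range h a b = trans (∑-map h (a ℕ.+_) (upTo (suc b ∸ a))) (∑-applyUpTo (λ i → h (a ℕ.+ i)) (λ i → i) (suc b ∸ a))

Σ<-snoc : ∀ j f → Σ< (suc j) f ≈ Σ< j f +ₚ f j
Σ<-snoc zero    f = +-comm (f 0) 0ₚ
Σ<-snoc (suc j) f = ≈-trans (+-congˡ (Σ<-snoc j (f ∘ suc))) (≈-sym (+-assoc (f 0) _ _))

-- The clauses  ¬c_i ∨ a_i ∨ c_{i+1}  (i < j) of a chain telescope:
-- their polynomials add up to  Σ_{i<j} a_i + c_j - c_0.
telescope : ∀ (a c : ℕ → Poly) j →
  Σ< j (λ i → (1ₚ -ₚ c i) +ₚ (a i +ₚ (c (suc i) +ₚ κ (- 1ℚ)))) ≈ Σ< j a +ₚ (c j -ₚ c 0)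
telescope a c zero    = ≈-sym (≈-trans (+-congˡ (-‿inverseʳ (c 0))) (+-identityʳ 0ₚ))
telescope a c (suc j) = ≈-trans (+-congˡ (telescope (a ∘ suc) (c ∘ suc) j))
  (solve 5 (λ c₀ a₀ c₁ A cⱼ → con 1ℚ :- c₀ :+ (a₀ :+ (c₁ :+ con (- 1ℚ))) :+ (A :+ (cⱼ :- c₁)) := a₀ :+ A :+ (cⱼ :- c₀))
         ≈-refl (c 0) (a 0) (c 1) (Σ< j (a ∘ suc)) (c (suc j)))

-- The pigeon and colouring
-- axioms are the sums of their chains of 3-clauses, which telescope; a
-- colour-class axiom goes through the extension variable r_{v,v'}.
module ERPHPRefutation (n' k' : ℕ) where
  n k : ℕ
  n = suc (suc (suc (suc n')))
  k = suc (suc (suc (suc k')))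

  F : CNF
  F = ERPHP n k

  xY xZ : ℕ → ℕ → Poly
  xY u v = var (Y u v)
  xZ v w = var (Z v w)

  pigeon-starts pigeon-links pigeon-ends colouring-starts colouring-links colouring-ends
    exclusion-clauses hole-clauses extension-clauses colour-class-clauses : CNF
  pigeon-starts     = map (λ u → pos (P u 1) ∷ pos (P u 2) ∷ pos (Y u 2) ∷ []) [ k ]
  pigeon-links      = concatMap (λ u → map (λ v → neg (Y u v) ∷ pos (P u (suc v)) ∷ pos (Y u (suc v)) ∷ [])
                                               (range 2 (n ∸ 3))) [ k ]
  pigeon-ends       = map (λ u → neg (Y u (n ∸ 2)) ∷ pos (P u (n ∸ 1)) ∷ pos (P u n) ∷ []) [ k ]
  colouring-starts  = map (λ v → neg (R v) ∷ pos (Q v 1) ∷ pos (Z v 1) ∷ []) [ n ]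
  colouring-links   = concatMap (λ v → map (λ w → neg (Z v w) ∷ pos (Q v (suc w)) ∷ pos (Z v (suc w)) ∷ [])
                                               [ k ∸ 4 ]) [ n ]
  colouring-ends    = map (λ v → neg (Z v (k ∸ 3)) ∷ pos (Q v (k ∸ 2)) ∷ pos (Q v (k ∸ 1)) ∷ []) [ n ]
  exclusion-clauses = concatMap (λ uu' → map (λ v → neg (P (proj₁ uu') v) ∷ neg (P (proj₂ uu') v) ∷ []) [ n ])
                                (distinctPairs [ k ])
  hole-clauses      = concatMap (λ u → map (λ v → neg (P u v) ∷ pos (R v) ∷ []) [ n ]) [ k ]
  extension-clauses = map (λ vv' → neg (R (proj₁ vv')) ∷ neg (R (proj₂ vv')) ∷ pos (RR (proj₁ vv') (proj₂ vv')) ∷ [])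
                          (distinctPairs [ n ])
  colour-class-clauses = concatMap (λ vv' → map (λ w → neg (RR (proj₁ vv') (proj₂ vv')) ∷ neg (Q (proj₁ vv') w)
                                                      ∷ neg (Q (proj₂ vv') w) ∷ []) [ k ∸ 1 ])
                                   (distinctPairs [ n ])

  pigeon-start : ∀ {u} → u ∈ [ k ] → (pos (P u 1) ∷ pos (P u 2) ∷ pos (Y u 2) ∷ []) ∈ F
  pigeon-start u∈ = ∈.∈-++⁺ˡ (∈.∈-map⁺ (λ u → pos (P u 1) ∷ pos (P u 2) ∷ pos (Y u 2) ∷ []) u∈)

  pigeon-link : ∀ {u v} → u ∈ [ k ] → v ∈ range 2 (n ∸ 3) →
                (neg (Y u v) ∷ pos (P u (suc v)) ∷ pos (Y u (suc v)) ∷ []) ∈ F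
  pigeon-link {u} u∈ v∈ = ∈.∈-++⁺ʳ pigeon-starts (∈.∈-++⁺ˡ
    (∈-concatMap⁺′ (λ u → map (λ v → neg (Y u v) ∷ pos (P u (suc v)) ∷ pos (Y u (suc v)) ∷ []) (range 2 (n ∸ 3))) u∈
      (∈.∈-map⁺ (λ v → neg (Y u v) ∷ pos (P u (suc v)) ∷ pos (Y u (suc v)) ∷ []) v∈)))

  pigeon-end : ∀ {u} → u ∈ [ k ] → (neg (Y u (n ∸ 2)) ∷ pos (P u (n ∸ 1)) ∷ pos (P u n) ∷ []) ∈ F
  pigeon-end u∈ = ∈.∈-++⁺ʳ pigeon-starts (∈.∈-++⁺ʳ pigeon-links (∈.∈-++⁺ˡ
    (∈.∈-map⁺ (λ u → neg (Y u (n ∸ 2)) ∷ pos (P u (n ∸ 1)) ∷ pos (P u n) ∷ []) u∈)))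

  after-pigeon-chains : ∀ {C} → C ∈ colouring-starts ++ colouring-links ++ colouring-ends ++ exclusion-clauses
                                   ++ hole-clauses ++ extension-clauses ++ colour-class-clauses → C ∈ F
  after-pigeon-chains C∈ = ∈.∈-++⁺ʳ pigeon-starts (∈.∈-++⁺ʳ pigeon-links (∈.∈-++⁺ʳ pigeon-ends C∈))

  colouring-start : ∀ {v} → v ∈ [ n ] → (neg (R v) ∷ pos (Q v 1) ∷ pos (Z v 1) ∷ []) ∈ F
  colouring-start v∈ = after-pigeon-chains (∈.∈-++⁺ˡ (∈.∈-map⁺ (λ v → neg (R v) ∷ pos (Q v 1) ∷ pos (Z v 1) ∷ []) v∈))

  colouring-link : ∀ {v w} → v ∈ [ n ] → w ∈ [ k ∸ 4 ] →
                   (neg (Z v w) ∷ pos (Q v (suc w)) ∷ pos (Z v (suc w)) ∷ []) ∈ F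
  colouring-link {v} v∈ w∈ = after-pigeon-chains (∈.∈-++⁺ʳ colouring-starts (∈.∈-++⁺ˡ
    (∈-concatMap⁺′ (λ v → map (λ w → neg (Z v w) ∷ pos (Q v (suc w)) ∷ pos (Z v (suc w)) ∷ []) [ k ∸ 4 ]) v∈
      (∈.∈-map⁺ (λ w → neg (Z v w) ∷ pos (Q v (suc w)) ∷ pos (Z v (suc w)) ∷ []) w∈))))

  colouring-end : ∀ {v} → v ∈ [ n ] → (neg (Z v (k ∸ 3)) ∷ pos (Q v (k ∸ 2)) ∷ pos (Q v (k ∸ 1)) ∷ []) ∈ F
  colouring-end v∈ = after-pigeon-chains (∈.∈-++⁺ʳ colouring-starts (∈.∈-++⁺ʳ colouring-links (∈.∈-++⁺ˡ
    (∈.∈-map⁺ (λ v → neg (Z v (k ∸ 3)) ∷ pos (Q v (k ∸ 2)) ∷ pos (Q v (k ∸ 1)) ∷ []) v∈))))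

  after-chains : ∀ {C} → C ∈ exclusion-clauses ++ hole-clauses ++ extension-clauses ++ colour-class-clauses → C ∈ F
  after-chains C∈ = after-pigeon-chains (∈.∈-++⁺ʳ colouring-starts (∈.∈-++⁺ʳ colouring-links (∈.∈-++⁺ʳ colouring-ends C∈)))

  exclusion-clause : ∀ {u u' v} → (u , u') ∈ distinctPairs [ k ] → v ∈ [ n ] → (neg (P u v) ∷ neg (P u' v) ∷ []) ∈ F
  exclusion-clause {u} {u'} uu'∈ v∈ = after-chains (∈.∈-++⁺ˡ
    (∈-concatMap⁺′ (λ uu' → map (λ v → neg (P (proj₁ uu') v) ∷ neg (P (proj₂ uu') v) ∷ []) [ n ]) uu'∈
      (∈.∈-map⁺ (λ v → neg (P u v) ∷ neg (P u' v) ∷ []) v∈)))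

  hole-clause : ∀ {u v} → u ∈ [ k ] → v ∈ [ n ] → (neg (P u v) ∷ pos (R v) ∷ []) ∈ F
  hole-clause {u} u∈ v∈ = after-chains (∈.∈-++⁺ʳ exclusion-clauses (∈.∈-++⁺ˡ
    (∈-concatMap⁺′ (λ u → map (λ v → neg (P u v) ∷ pos (R v) ∷ []) [ n ]) u∈
      (∈.∈-map⁺ (λ v → neg (P u v) ∷ pos (R v) ∷ []) v∈))))

  extension-clause : ∀ {v v'} → (v , v') ∈ distinctPairs [ n ] → (neg (R v) ∷ neg (R v') ∷ pos (RR v v') ∷ []) ∈ F
  extension-clause vv'∈ = after-chains (∈.∈-++⁺ʳ exclusion-clauses (∈.∈-++⁺ʳ hole-clauses (∈.∈-++⁺ˡ
    (∈.∈-map⁺ (λ vv' → neg (R (proj₁ vv')) ∷ neg (R (proj₂ vv')) ∷ pos (RR (proj₁ vv') (proj₂ vv')) ∷ []) vv'∈))))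

  colour-class-clause : ∀ {v v' w} → (v , v') ∈ distinctPairs [ n ] → w ∈ [ k ∸ 1 ] →
                        (neg (RR v v') ∷ neg (Q v w) ∷ neg (Q v' w) ∷ []) ∈ F
  colour-class-clause {v} {v'} vv'∈ w∈ = after-chains (∈.∈-++⁺ʳ exclusion-clauses (∈.∈-++⁺ʳ hole-clauses (∈.∈-++⁺ʳ extension-clauses
    (∈-concatMap⁺′ (λ vv' → map (λ w → neg (RR (proj₁ vv') (proj₂ vv')) ∷ neg (Q (proj₁ vv') w) ∷ neg (Q (proj₂ vv') w) ∷ [])
                                [ k ∸ 1 ]) vv'∈
      (∈.∈-map⁺ (λ w → neg (RR v v') ∷ neg (Q v w) ∷ neg (Q v' w) ∷ []) w∈)))))

  -- every hole has another hole, so every q_vw occurs in a colour-class clause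
  other-hole : ∀ v → Σ ℕ λ v' → v' ∈ [ n ] × v ≢ v'
  other-hole v with v ℕ.≟ 1
  ... | yes refl = 2 , there (here refl) , (λ ())
  ... | no v≢1   = 1 , here refl , v≢1

  r-var : ∀ {v} → v ∈ [ n ] → IsVarOf F (R v)
  r-var v∈ = occursIn (colouring-start v∈) (here refl)

  q-var : ∀ {v w} → v ∈ [ n ] → w ∈ [ k ∸ 1 ] → IsVarOf F (Q v w)
  q-var {v} v∈ w∈ with other-hole v
  ... | v' , v'∈ , v≢v' = occursIn (colour-class-clause (∈-distinctPairs⁺ [ n ] v∈ v'∈ v≢v') w∈) (there (here refl))

  pigeon-axiom : ∀ {u} → u ∈ [ k ] → Derivable 9 F (∑ (xP u) [ n ] -ₚ 1ₚ)
  pigeon-axiom {u} u∈ =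
    derivable-≈ chain-sum
      (derivable-+ (derivable-clause [] (pigeon-start u∈) [])
      (derivable-+ (derivable-∑ (λ v → ∏ [] *ₚ clauseₚ (link v)) (range 2 (n ∸ 3)) (λ v∈ → derivable-clause [] (pigeon-link u∈ v∈) []))
                   (derivable-clause [] (pigeon-end u∈) [])))
    where
    link : ℕ → Clause
    link v = neg (Y u v) ∷ pos (P u (suc v)) ∷ pos (Y u (suc v)) ∷ []
    hole chain : ℕ → Poly
    hole  i = xP u (3 ℕ.+ i)
    chain i = xY u (2 ℕ.+ i)
    links : ∑ (λ v → ∏ [] *ₚ clauseₚ (link v)) (range 2 (n ∸ 3)) ≈ Σ< n' hole +ₚ (chain n' -ₚ chain 0)
    links = ≈-trans (∑-cong (range 2 (n ∸ 3)) (λ v → *-identityˡ _))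
                    (≈-trans (≡⇒≈ (∑-range (clauseₚ ∘ link) 2 (n ∸ 3))) (telescope hole chain n'))
    all-holes : ∑ (xP u) [ n ] ≈ xP u 1 +ₚ (xP u 2 +ₚ (Σ< n' hole +ₚ hole n' +ₚ hole (suc n')))
    all-holes = ≈-trans (≡⇒≈ (∑-range (xP u) 1 n))
      (+-congˡ (+-congˡ (≈-trans (Σ<-snoc (suc n') hole) (+-congʳ (Σ<-snoc n' hole)))))
    chain-sum : ∏ [] *ₚ clauseₚ (pos (P u 1) ∷ pos (P u 2) ∷ pos (Y u 2) ∷ [])
                +ₚ (∑ (λ v → ∏ [] *ₚ clauseₚ (link v)) (range 2 (n ∸ 3))
                +ₚ ∏ [] *ₚ clauseₚ (neg (Y u (n ∸ 2)) ∷ pos (P u (n ∸ 1)) ∷ pos (P u n) ∷ []))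
                ≈ ∑ (xP u) [ n ] -ₚ 1ₚ
    chain-sum = ≈-trans (+-congˡ (+-congʳ links))
      (≈-trans (solve 7 (λ p₁ p₂ y₀ H yₑ pₐ p_b →
          con 1ℚ :* (p₁ :+ (p₂ :+ (y₀ :+ con (- 1ℚ)))) :+ (H :+ (yₑ :- y₀)
          :+ con 1ℚ :* (con 1ℚ :- yₑ :+ (pₐ :+ (p_b :+ con (- 1ℚ)))))
          := p₁ :+ (p₂ :+ (H :+ pₐ :+ p_b)) :- con 1ℚ)
        ≈-refl (xP u 1) (xP u 2) (chain 0) (Σ< n' hole) (chain n') (hole n') (hole (suc n')))
      (+-congʳ (≈-sym all-holes)))

  colouring-axiom : ∀ {v} → v ∈ [ n ] → Derivable 9 F (xR v *ₚ ∑ (xQ v) [ k ∸ 1 ] -ₚ xR v)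
  colouring-axiom {v} v∈ =
    derivable-≈ chain-sum
      (derivable-+ (derivable-clause (R v ∷ []) (colouring-start v∈) (rv ∷ []))
      (derivable-+ (derivable-∑ (λ w → ∏ (R v ∷ []) *ₚ clauseₚ (link w)) [ k ∸ 4 ]
                                (λ w∈ → derivable-clause (R v ∷ []) (colouring-link v∈ w∈) (rv ∷ [])))
      (derivable-+ (derivable-clause (R v ∷ []) (colouring-end v∈) (rv ∷ []))
                   (derivable-x²-x [] (R v) [] rv))))
    where
    rv = r-var v∈
    link : ℕ → Clause
    link w = neg (Z v w) ∷ pos (Q v (suc w)) ∷ pos (Z v (suc w)) ∷ []
    colour chain : ℕ → Poly
    colour i = xQ v (2 ℕ.+ i)
    chain  i = xZ v (1 ℕ.+ i)
    links : ∑ (λ w → ∏ (R v ∷ []) *ₚ clauseₚ (link w)) [ k ∸ 4 ] ≈ ∏ (R v ∷ []) *ₚ (Σ< k' colour +ₚ (chain k' -ₚ chain 0))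
    links = ≈-trans (≈-sym (∑-*ˡ (∏ (R v ∷ [])) (clauseₚ ∘ link) [ k ∸ 4 ]))
                    (*-congˡ (≈-trans (≡⇒≈ (∑-range (clauseₚ ∘ link) 1 k')) (telescope colour chain k')))
    all-colours : ∑ (xQ v) [ k ∸ 1 ] ≈ xQ v 1 +ₚ (Σ< k' colour +ₚ colour k' +ₚ colour (suc k'))
    all-colours = ≈-trans (≡⇒≈ (∑-range (xQ v) 1 (k ∸ 1)))
      (+-congˡ (≈-trans (Σ<-snoc (suc k') colour) (+-congʳ (Σ<-snoc k' colour))))
    chain-sum : ∏ (R v ∷ []) *ₚ clauseₚ (neg (R v) ∷ pos (Q v 1) ∷ pos (Z v 1) ∷ [])
                +ₚ (∑ (λ w → ∏ (R v ∷ []) *ₚ clauseₚ (link w)) [ k ∸ 4 ]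
                +ₚ (∏ (R v ∷ []) *ₚ clauseₚ (neg (Z v (k ∸ 3)) ∷ pos (Q v (k ∸ 2)) ∷ pos (Q v (k ∸ 1)) ∷ [])
                +ₚ ∏ [] *ₚ (xR v *ₚ xR v -ₚ xR v)))
                ≈ xR v *ₚ ∑ (xQ v) [ k ∸ 1 ] -ₚ xR v
    chain-sum = ≈-trans (+-congˡ (+-congʳ links))
      (≈-trans (solve 7 (λ r q₁ z₀ G zₑ qₐ q_b →
          r :* con 1ℚ :* (con 1ℚ :- r :+ (q₁ :+ (z₀ :+ con (- 1ℚ))))
          :+ (r :* con 1ℚ :* (G :+ (zₑ :- z₀))
          :+ (r :* con 1ℚ :* (con 1ℚ :- zₑ :+ (qₐ :+ (q_b :+ con (- 1ℚ)))) :+ con 1ℚ :* (r :* r :- r)))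
          := r :* (q₁ :+ (G :+ qₐ :+ q_b)) :- r)
        ≈-refl (xR v) (xQ v 1) (chain 0) (Σ< k' colour) (chain k') (colour k') (colour (suc k')))
      (+-congʳ (*-congˡ (≈-sym all-colours))))

  -- through the extension variable e = r_{v,v'}:
  -- r r' q q' (¬r ∨ ¬r' ∨ e) + r r' q q' e (¬e ∨ ¬q ∨ ¬q') + Boolean axioms = - r q r' q'
  colour-class-axiom : ∀ {v v' w} → (v , v') ∈ distinctPairs [ n ] → w ∈ [ k ∸ 1 ] →
                       Derivable 9 F (-ₚ (xR v *ₚ xQ v w *ₚ (xR v' *ₚ xQ v' w)))
  colour-class-axiom {v} {v'} {w} vv'∈ w∈ =
    derivable-≈ (solve 5 (λ r r' q q' e →
        r :* (r' :* (q :* (q' :* con 1ℚ))) :* (con 1ℚ :- r :+ (con 1ℚ :- r' :+ (e :+ con (- 1ℚ))))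
        :+ (r :* (r' :* (q :* (q' :* (e :* con 1ℚ)))) :* (con 1ℚ :- e :+ (con 1ℚ :- q :+ (con 1ℚ :- q' :+ con (- 1ℚ))))
        :+ (r' :* (q :* (q' :* con 1ℚ)) :* (r :* r :- r)
        :+ (r :* (q :* (q' :* con 1ℚ)) :* (r' :* r' :- r')
        :+ (r :* (r' :* (q :* (q' :* con 1ℚ))) :* (e :* e :- e)
        :+ (r :* (r' :* (q' :* (e :* con 1ℚ))) :* (q :* q :- q)
        :+ r :* (r' :* (q :* (e :* con 1ℚ))) :* (q' :* q' :- q'))))))
        := :- (r :* q :* (r' :* q'))) ≈-refl (xR v) (xR v') (xQ v w) (xQ v' w) (var (RR v v')))
      (derivable-+ (derivable-clause (R v ∷ R v' ∷ Q v w ∷ Q v' w ∷ []) (extension-clause vv'∈) (rv ∷ rv' ∷ qv ∷ qv' ∷ []))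
      (derivable-+ (derivable-clause (R v ∷ R v' ∷ Q v w ∷ Q v' w ∷ RR v v' ∷ []) (colour-class-clause vv'∈ w∈)
                                     (rv ∷ rv' ∷ qv ∷ qv' ∷ ev ∷ []))
      (derivable-+ (derivable-x²-x (R v' ∷ Q v w ∷ Q v' w ∷ []) (R v) (rv' ∷ qv ∷ qv' ∷ []) rv)
      (derivable-+ (derivable-x²-x (R v ∷ Q v w ∷ Q v' w ∷ []) (R v') (rv ∷ qv ∷ qv' ∷ []) rv')
      (derivable-+ (derivable-x²-x (R v ∷ R v' ∷ Q v w ∷ Q v' w ∷ []) (RR v v') (rv ∷ rv' ∷ qv ∷ qv' ∷ []) ev)
      (derivable-+ (derivable-x²-x (R v ∷ R v' ∷ Q v' w ∷ RR v v' ∷ []) (Q v w) (rv ∷ rv' ∷ qv' ∷ ev ∷ []) qv)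
                   (derivable-x²-x (R v ∷ R v' ∷ Q v w ∷ RR v v' ∷ []) (Q v' w) (rv ∷ rv' ∷ qv ∷ ev ∷ []) qv')))))))
    where
    v∈  = proj₁ (∈-distinctPairs⁻ [ n ] vv'∈)
    v'∈ = proj₂ (∈-distinctPairs⁻ [ n ] vv'∈)
    rv  = r-var v∈
    rv' = r-var v'∈
    qv  = q-var v∈ w∈
    qv' = q-var v'∈ w∈
    ev  = occursIn (extension-clause vv'∈) (there (there (here refl)))

  open CountingArgument F [ k ] [ n ] [ k ∸ 1 ] ([]-unique k) ([]-unique n)
    (trans ([]-length k) (cong suc (sym ([]-length (k ∸ 1)))))
    hole-clause exclusion-clause q-var pigeon-axiom colouring-axiom colour-class-axiom
    public using (refutation)

lemma5p2 : ((n k : ℕ) → 1 ≤ k → LasserreRefutation (RPHP n k) 9)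
         × ((n k : ℕ) → 4 ≤ n → 4 ≤ k → LasserreRefutation (ERPHP n k) 9)
lemma5p2 = rphp , erphp
  where
  rphp : (n k : ℕ) → 1 ≤ k → LasserreRefutation (RPHP n k) 9
  rphp n (suc k') _ = RPHPRefutation.refutation n k'
  erphp : (n k : ℕ) → 4 ≤ n → 4 ≤ k → LasserreRefutation (ERPHP n k) 9
  erphp (suc (suc (suc (suc n')))) (suc (suc (suc (suc k')))) (s≤s (s≤s (s≤s (s≤s _)))) (s≤s (s≤s (s≤s (s≤s _)))) =
    ERPHPRefutation.refutation n' k'
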